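{- Let $\mathcal{N}$ be the class of simple binary matroids that do not have $M(K_4)$ as an induced minor. Then $\mathcal{N}$ is closed under the following operations: (i) generalized parallel connections (of members of $\mathcal{N}$) across projective geometries; (ii) tipped coning; and (iii) tipless coning of triangle-free matroids.
   Context: All matroids are simple and binary; every contraction is immediately followed by simplification. An induced minor of $M$ is a matroid obtained from $M$ by a sequence of restrictions to flats and contractions (each contraction followed by simplification). For matroids $M_1,M_2$ with $E(M_1)\cap E(M_2)=T$ and $M_1|T=M_2|T=N$ a binary projective geometry, the generalized parallel connection $P_N(M_1,M_2)$ is the matroid on $E(M_1)\cup E(M_2)$ whose flats are the sets $X$ with $X\cap E(M_i)$ a flat of $M_i$ for $i=1,2$. For a simple binary matroid $N$, its (tipped) coning $A(N)$ is obtained by adding a coloop $p$ and then the third point on each projective line between $p$ and a point of $N$; its tipless coning is $A(N)\backslash p$. A matroid is triangle-free if it has no 3-element circuits. -}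

module Defs where

open import Data.Bool using (Bool; true; false; _xor_)
open import Data.Nat using (ℕ; suc)
open import Data.Vec using (Vec; []; _∷_; zipWith; replicate)
open import Data.List using (List; []; foldr)
open import Data.List.Relation.Unary.All using (All)
open import Data.List.Relation.Unary.Unique.Propositional using (Unique)
open import Data.Product using (Σ; ∃; _×_; _,_)
open import Data.Sum using (_⊎_; inj₁; inj₂)
open import Data.Empty using (⊥)
open import Relation.Nullary using (¬_)
open import Relation.Binary.PropositionalEquality using (_≡_; _≢_; refl)
open import Function.Bundles using (_⇔_)
open import Level using (0ℓ)

V : ℕ → Set
V r = Vec Bool r

_⊕_ : ∀ {r} → V r → V r → V r
_⊕_ = zipWith _xor_

𝟘 : ∀ {r} → V r
𝟘 = replicate _ false

sumV : ∀ {r} → List (V r) → V r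
sumV = foldr _⊕_ 𝟘

Subset : ℕ → Set₁
Subset r = V r → Set

_⊆_ : ∀ {r} → Subset r → Subset r → Set
X ⊆ Y = ∀ v → X v → Y v

LinIndep : ∀ {r} → Subset r → Set
LinIndep X = ∀ (L : List (V _)) → Unique L → All X L → L ≢ [] → sumV L ≢ 𝟘

InSpan : ∀ {r} → Subset r → V r → Set
InSpan X v = Σ (List (V _)) λ L → All X L × sumV L ≡ v

-- Simple binary matroids, represented by a set of distinct nonzero
-- vectors of GF(2)^r (simple: no loops, no parallel elements).

record BinMat (r : ℕ) : Set₁ where
  field
    pts     : Subset r
    nonzero : ∀ v → pts v → v ≢ 𝟘
open BinMat public

Indep : ∀ {r} → BinMat r → Subset r → Set
Indep M X = X ⊆ pts M × LinIndep X

Flat : ∀ {r} → BinMat r → Subset r → Set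
Flat M X = X ⊆ pts M × (∀ v → pts M v → InSpan X v → X v)

restrict : ∀ {r} (M : BinMat r) (X : Subset r) → X ⊆ pts M → BinMat r
restrict M X X⊆ = record { pts = X ; nonzero = λ v x → nonzero M v (X⊆ v x) }

img : ∀ {s r} → (V s → V r) → Subset s → Subset r
img f X v = Σ (V _) λ u → X u × f u ≡ v

record Iso {s r} (N : BinMat s) (M : BinMat r) : Set₁ where
  field
    f     : V s → V r
    g     : V r → V s
    f-pts : ∀ u → pts N u → pts M (f u)
    g-pts : ∀ v → pts M v → pts N (g v)
    gf    : ∀ u → pts N u → g (f u) ≡ u
    fg    : ∀ v → pts M v → f (g v) ≡ v
    indep : ∀ X → X ⊆ pts N → (Indep N X ⇔ Indep M (img f X))

-- Contraction of a point e followed by simplification.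
-- Realised via any linear map φ whose kernel is exactly {0, e}:
-- the points of M/e (simplified) are the images φ v of points v ≠ e.

Linear : ∀ {r r'} → (V r → V r') → Set
Linear φ = ∀ u v → φ (u ⊕ v) ≡ φ u ⊕ φ v

KernelIs : ∀ {r r'} → (V r → V r') → V r → Set
KernelIs φ e = ∀ v → (φ v ≡ 𝟘 ⇔ (v ≡ 𝟘 ⊎ v ≡ e))

contractPts : ∀ {r r'} → BinMat r → V r → (V r → V r') → Subset r'
contractPts M e φ w = Σ (V _) λ v → pts M v × v ≢ e × φ v ≡ w

contract : ∀ {r r'} (M : BinMat r) (e : V r) (φ : V r → V r') →
           KernelIs φ e → BinMat r'
contract M e φ ker = record
  { pts = contractPts M e φ
  ; nonzero = nz }
  where
  open import Relation.Binary.PropositionalEquality using (trans)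
  open Function.Bundles.Equivalence
  nz : ∀ w → contractPts M e φ w → w ≢ 𝟘
  nz w (v , pv , v≢e , φv≡w) w≡0 with to (ker v) (trans φv≡w w≡0)
  ... | inj₁ v≡0 = nonzero M v pv v≡0
  ... | inj₂ v≡e = v≢e v≡e

-- Induced minors: N ≼ M iff N is isomorphic to a matroid obtained from
-- M by a sequence of restrictions to flats and contractions (each
-- followed by simplification).

data _≼_ {s : ℕ} (N : BinMat s) : ∀ {r} → BinMat r → Set₁ where
  iso   : ∀ {r} {M : BinMat r} → Iso N M → N ≼ M
  restr : ∀ {r} {M : BinMat r} (F : Subset r) (fl : Flat M F) →
          N ≼ restrict M F (Data.Product.proj₁ fl) → N ≼ M
  contr : ∀ {r r'} {M : BinMat r} (e : V r) → pts M e →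
          (φ : V r → V r') → Linear φ → (ker : KernelIs φ e) →
          N ≼ contract M e φ ker → N ≼ M

MK4 : BinMat 3
MK4 = record { pts = λ v → v ≢ 𝟘 × v ≢ (true ∷ true ∷ true ∷ []) ; nonzero = λ v p → Data.Product.proj₁ p }

-- PG(k-1,2): all nonzero vectors of GF(2)^k
PG : (k : ℕ) → BinMat k
PG k = record { pts = λ v → v ≢ 𝟘 ; nonzero = λ v p → p }

IsProjGeom : ∀ {r} → BinMat r → Set₁
IsProjGeom M = Σ ℕ λ k → Iso (PG k) M

InN : ∀ {r} → BinMat r → Set₁
InN M = ¬ (MK4 ≼ M)

-- IsGPC M₁ M₂ M : M is (a binary representation of) P_N(M₁,M₂).
-- ι₁, ι₂ identify E(M₁), E(M₂) with subsets of E(M) covering E(M);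
-- T is their common part; M₁|T = M₂|T (same independent sets under the
-- identification) is a projective geometry; the flats of M are exactly
-- the X ⊆ E(M) with X ∩ E(Mᵢ) a flat of Mᵢ.

module _ {r₁ r₂ r : ℕ} (M₁ : BinMat r₁) (M₂ : BinMat r₂) (M : BinMat r) where

  pre : ∀ {s} → BinMat s → (V s → V r) → Subset r → Subset s
  pre Mi ι X x = pts Mi x × X (ι x)

  record IsGPC : Set₁ where
    field
      ι₁ : V r₁ → V r
      ι₂ : V r₂ → V r
      ι₁-pts : ∀ x → pts M₁ x → pts M (ι₁ x)
      ι₂-pts : ∀ y → pts M₂ y → pts M (ι₂ y)
      ι₁-inj : ∀ x x' → pts M₁ x → pts M₁ x' → ι₁ x ≡ ι₁ x' → x ≡ x'
      ι₂-inj : ∀ y y' → pts M₂ y → pts M₂ y' → ι₂ y ≡ ι₂ y' → y ≡ y'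
      cover  : ∀ v → pts M v →
               (Σ (V r₁) λ x → pts M₁ x × ι₁ x ≡ v) ⊎ (Σ (V r₂) λ y → pts M₂ y × ι₂ y ≡ v)
    T : Subset r
    T v = (Σ (V r₁) λ x → pts M₁ x × ι₁ x ≡ v) × (Σ (V r₂) λ y → pts M₂ y × ι₂ y ≡ v)
    field
      sameRestr : ∀ X → X ⊆ T → (LinIndep (pre M₁ ι₁ X) ⇔ LinIndep (pre M₂ ι₂ X))
      projGeom  : IsProjGeom (restrict M₁ (pre M₁ ι₁ T) (λ x p → Data.Product.proj₁ p))
      flats     : ∀ X → X ⊆ pts M →
                  (Flat M X ⇔ (Flat M₁ (pre M₁ ι₁ X) × Flat M₂ (pre M₂ ι₂ X)))

-- Conings. Coordinates of GF(2)^(r+1) are (b ∷ v); the new coloop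
-- p = (1 ∷ 0); N sits as (0 ∷ v), and the third point of the line
-- through p and (0 ∷ v) is (1 ∷ v).

conePts : ∀ {r} → BinMat r → Subset (suc r)
conePts N (false ∷ v) = pts N v
conePts N (true ∷ v)  = v ≡ 𝟘 ⊎ pts N v

tiplessPts : ∀ {r} → BinMat r → Subset (suc r)
tiplessPts N (false ∷ v) = pts N v
tiplessPts N (true ∷ v)  = pts N v

private
  cone-nz : ∀ {r} (N : BinMat r) v → conePts N v → v ≢ 𝟘
  cone-nz N (false ∷ v) p refl = nonzero N v p refl
  cone-nz N (true ∷ v) p ()

  tipless-nz : ∀ {r} (N : BinMat r) v → tiplessPts N v → v ≢ 𝟘
  tipless-nz N (false ∷ v) p refl = nonzero N v p refl
  tipless-nz N (true ∷ v) p ()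

cone : ∀ {r} → BinMat r → BinMat (suc r)
cone N = record { pts = conePts N ; nonzero = cone-nz N }

tiplessCone : ∀ {r} → BinMat r → BinMat (suc r)
tiplessCone N = record { pts = tiplessPts N ; nonzero = tipless-nz N }

TriangleFree : ∀ {r} → BinMat r → Set
TriangleFree N = ∀ a b c → pts N a → pts N b → pts N c →
                 a ≢ b → a ≢ c → b ≢ c → (a ⊕ b) ⊕ c ≢ 𝟘

{-# OPTIONS --safe #-}
-- M(K4) is an induced minor of M exactly when M has a flat F and a list C ⊆ F
-- such that, modulo the span of C, the points of F are the six combinations
-- of three vectors a, b, c with coefficients in GF(2)^3 ∖ {0, 𝟙}
-- (K4Certificate); restricting and contracting only change F and C. Each
-- closure property is proved by turning a certificate for the new matroid
-- into one for an old one.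
--
-- Coning: projecting away the apex p works unless p ≡ a ⊕ b ⊕ c modulo ⟨C⟩.
-- In the tipped cone p is then a point of F represented by 𝟙, which is
-- impossible; in the tipless cone an element of C would produce such a point,
-- and if C is empty the projections of a, b and a ⊕ b form a triangle of N.
--
-- Parallel connection across T: every point of the M(K4) is realised in
-- E(M₁) or in E(M₂). Since T is modular (a vector spanned by E(M₁) and by
-- E(M₂) lies in T ∪ {0}), the points realised in E(Mᵢ) are closed under the
-- triangles of M(K4), so one side realises all six. The certificate then
-- restricts to that side, because ι₁ preserves and reflects linear dependence.

module Submission where

open import Defs
open import Algebra.Bundles using (Monoid)
open import Level using (0ℓ)
import Algebra.Solver.Monoid.Expression as MonoidExpression
import Algebra.Solver.Monoid.Solver as MonoidSolver
open import Data.Bool using (Bool; true; false; _xor_; if_then_else_)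
import Data.Bool.Properties as Boolₚ
open import Data.Empty using (⊥; ⊥-elim)
open import Data.Fin using (Fin; zero; suc)
open import Data.List using (List; []; _∷_; map; length; _++_; filter)
import Data.List.Properties as Listₚ
open import Data.List.Membership.Propositional using (_∈_; lose)
open import Data.List.Membership.Propositional.Properties using (∈-map⁺; ∈-map⁻; ∈-++⁺ˡ; ∈-++⁺ʳ; ∈-++⁻; ∈-filter⁺; ∈-filter⁻)
open import Data.List.Relation.Unary.All as All using (All; []; _∷_)
import Data.List.Relation.Unary.All.Properties as Allₚ
import Data.List.Membership.DecPropositional
import Data.List.Relation.Unary.Unique.Propositional.Properties as Uniqueₚ
open import Data.List.Relation.Unary.Any as Any using (Any; here; there)
open import Data.List.Relation.Unary.AllPairs using ([]; _∷_)
open import Data.List.Relation.Unary.Unique.Propositional using (Unique)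
open import Data.Nat using (ℕ; zero; suc; _+_; _≤_; z≤n; s≤s)
import Data.Nat.Properties as ℕₚ
open import Data.Product using (Σ; _×_; _,_; proj₁; proj₂)
open import Data.Sum using (_⊎_; inj₁; inj₂; [_,_]′)
open import Data.Vec using (Vec; []; _∷_; zipWith; replicate; lookup)
import Data.Vec.Properties as Vecₚ
open import Function using (_∘_)
open import Function.Bundles using (_⇔_; mk⇔; Equivalence)
open import Relation.Nullary using (¬_; Dec; yes; no; ¬?; _×-dec_)
open import Relation.Nullary.Decidable using (True; toWitness)
open import Relation.Binary.PropositionalEquality
open ≡-Reasoning
open Equivalence using (to; from)

⊕-assoc : ∀ {r} (u v w : V r) → (u ⊕ v) ⊕ w ≡ u ⊕ (v ⊕ w)
⊕-assoc = Vecₚ.zipWith-assoc Boolₚ.xor-assoc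

⊕-comm : ∀ {r} (u v : V r) → u ⊕ v ≡ v ⊕ u
⊕-comm []      []      = refl
⊕-comm (x ∷ u) (y ∷ v) = cong₂ _∷_ (Boolₚ.xor-comm x y) (⊕-comm u v)

⊕-identityˡ : ∀ {r} (u : V r) → 𝟘 ⊕ u ≡ u
⊕-identityˡ = Vecₚ.zipWith-identityˡ Boolₚ.xor-identityˡ

⊕-identityʳ : ∀ {r} (u : V r) → u ⊕ 𝟘 ≡ u
⊕-identityʳ = Vecₚ.zipWith-identityʳ Boolₚ.xor-identityʳ

⊕-self : ∀ {r} (u : V r) → u ⊕ u ≡ 𝟘
⊕-self []      = refl
⊕-self (x ∷ u) = cong₂ _∷_ (Boolₚ.xor-same x) (⊕-self u)

⊕-interchange : ∀ {r} (a b c d : V r) → (a ⊕ b) ⊕ (c ⊕ d) ≡ (a ⊕ c) ⊕ (b ⊕ d)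
⊕-interchange a b c d = begin
  (a ⊕ b) ⊕ (c ⊕ d)  ≡⟨ ⊕-assoc a b (c ⊕ d) ⟩
  a ⊕ (b ⊕ (c ⊕ d))  ≡⟨ cong (a ⊕_) (⊕-assoc b c d) ⟨
  a ⊕ ((b ⊕ c) ⊕ d)  ≡⟨ cong (λ x → a ⊕ (x ⊕ d)) (⊕-comm b c) ⟩
  a ⊕ ((c ⊕ b) ⊕ d)  ≡⟨ cong (a ⊕_) (⊕-assoc c b d) ⟩
  a ⊕ (c ⊕ (b ⊕ d))  ≡⟨ ⊕-assoc a c (b ⊕ d) ⟨
  (a ⊕ c) ⊕ (b ⊕ d)  ∎

⊕-monoid : ℕ → Monoid _ _
⊕-monoid r = record
  { Carrier = V r ; _≈_ = _≡_ ; _∙_ = _⊕_ ; ε = 𝟘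
  ; isMonoid = record
    { isSemigroup = record { isMagma = isMagma _⊕_ ; assoc = ⊕-assoc }
    ; identity = ⊕-identityˡ , ⊕-identityʳ } }

infix 4 _≟V_
_≟V_ : ∀ {r} (u v : V r) → Dec (u ≡ v)
_≟V_ = Vecₚ.≡-dec Boolₚ._≟_

infixr 25 _·_
_·_ : ∀ {r} → Bool → V r → V r
true  · u = u
false · u = 𝟘

·-distribʳ-xor : ∀ {r} b c (u : V r) → (b xor c) · u ≡ b · u ⊕ c · u
·-distribʳ-xor false c     u = sym (⊕-identityˡ _)
·-distribʳ-xor true  false u = sym (⊕-identityʳ u)
·-distribʳ-xor true  true  u = sym (⊕-self u)

-- An identity holds in every elementary abelian 2-group iff each variable
-- occurs with the same parity on both sides; normal forms are parity vectors.
module ⊕-Solver {r : ℕ} where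
  open MonoidExpression (Monoid.rawMonoid (⊕-monoid r)) renaming (_⊕_ to _⊞_) public

  private
    ⟦_⟧⇓ : ∀ {n} → Vec Bool n → Env n → V r
    ⟦ []    ⟧⇓ _       = 𝟘
    ⟦ b ∷ p ⟧⇓ (u ∷ ρ) = b · u ⊕ ⟦ p ⟧⇓ ρ

    singleton : ∀ {n} → Fin n → Vec Bool n
    singleton zero    = true ∷ replicate _ false
    singleton (suc i) = false ∷ singleton i

    normalise : ∀ {n} → Expr n → Vec Bool n
    normalise (var i) = singleton i
    normalise id      = replicate _ false
    normalise (e ⊞ f) = zipWith _xor_ (normalise e) (normalise f)

    empty-correct : ∀ {n} (ρ : Env n) → ⟦ replicate n false ⟧⇓ ρ ≡ 𝟘
    empty-correct []      = refl
    empty-correct (u ∷ ρ) = trans (⊕-identityˡ _) (empty-correct ρ)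

    singleton-correct : ∀ {n} (i : Fin n) (ρ : Env n) → ⟦ singleton i ⟧⇓ ρ ≡ lookup ρ i
    singleton-correct zero    (u ∷ ρ) = trans (cong (u ⊕_) (empty-correct ρ)) (⊕-identityʳ u)
    singleton-correct (suc i) (u ∷ ρ) = trans (⊕-identityˡ _) (singleton-correct i ρ)

    xor-correct : ∀ {n} (p q : Vec Bool n) (ρ : Env n) →
                  ⟦ zipWith _xor_ p q ⟧⇓ ρ ≡ ⟦ p ⟧⇓ ρ ⊕ ⟦ q ⟧⇓ ρ
    xor-correct []      []      []      = sym (⊕-self 𝟘)
    xor-correct (b ∷ p) (c ∷ q) (u ∷ ρ) = begin
      (b xor c) · u ⊕ ⟦ zipWith _xor_ p q ⟧⇓ ρ  ≡⟨ cong₂ _⊕_ (·-distribʳ-xor b c u) (xor-correct p q ρ) ⟩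
      (b · u ⊕ c · u) ⊕ (⟦ p ⟧⇓ ρ ⊕ ⟦ q ⟧⇓ ρ)   ≡⟨ ⊕-interchange _ _ _ _ ⟩
      (b · u ⊕ ⟦ p ⟧⇓ ρ) ⊕ (c · u ⊕ ⟦ q ⟧⇓ ρ)   ∎

    correct : ∀ {n} (e : Expr n) ρ → ⟦ normalise e ⟧⇓ ρ ≡ ⟦ e ⟧ ρ
    correct (var i) ρ = singleton-correct i ρ
    correct id      ρ = empty-correct ρ
    correct (e ⊞ f) ρ = trans (xor-correct (normalise e) (normalise f) ρ) (cong₂ _⊕_ (correct e ρ) (correct f ρ))

    parity : NormalAPI 0ℓ
    parity = record
      { Normal = Vec Bool ; _≟_ = Vecₚ.≡-dec Boolₚ._≟_ ; normalise = normalise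
      ; ⟦_⟧⇓ = ⟦_⟧⇓ ; correct = correct }

  open MonoidSolver (⊕-monoid r) parity public using (solve; _⊜_)

open ⊕-Solver using (solve; _⊜_; _⊞_; id)

⊕-cancelˡ : ∀ {r} (u v : V r) → u ⊕ (u ⊕ v) ≡ v
⊕-cancelˡ = solve 2 (λ u v → u ⊞ (u ⊞ v) ⊜ v) refl

⊕-cancelʳ : ∀ {r} (u v : V r) → (v ⊕ u) ⊕ u ≡ v
⊕-cancelʳ = solve 2 (λ u v → (v ⊞ u) ⊞ u ⊜ v) refl

⊕≡𝟘⇒≡ : ∀ {r} {u v : V r} → u ⊕ v ≡ 𝟘 → u ≡ v
⊕≡𝟘⇒≡ {u = u} {v} e = begin
  u            ≡⟨ ⊕-cancelʳ v u ⟨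
  (u ⊕ v) ⊕ v  ≡⟨ cong (_⊕ v) e ⟩
  𝟘 ⊕ v        ≡⟨ ⊕-identityˡ v ⟩
  v            ∎

≡⇒⊕≡𝟘 : ∀ {r} {u v : V r} → u ≡ v → u ⊕ v ≡ 𝟘
≡⇒⊕≡𝟘 {u = u} refl = ⊕-self u

⊕≡ˡ⇒≡𝟘 : ∀ {r} {u v : V r} → u ⊕ v ≡ u → v ≡ 𝟘
⊕≡ˡ⇒≡𝟘 {u = u} {v} e = trans (sym (⊕-cancelˡ u v)) (trans (cong (u ⊕_) e) (⊕-self u))

⊕≡ʳ⇒≡𝟘 : ∀ {r} {u v : V r} → u ⊕ v ≡ v → u ≡ 𝟘
⊕≡ʳ⇒≡𝟘 {u = u} {v} e = ⊕≡ˡ⇒≡𝟘 (trans (⊕-comm v u) e)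

⊕-move : ∀ {r} {u v w : V r} → u ⊕ v ≡ w → u ≡ v ⊕ w
⊕-move {u = u} {v} refl = sym (trans (cong (v ⊕_) (⊕-comm u v)) (⊕-cancelˡ v u))

allV : (k : ℕ) → List (V k)
allV zero    = [] ∷ []
allV (suc k) = map (true ∷_) (allV k) ++ map (false ∷_) (allV k)

∈-allV : ∀ {k} (v : V k) → v ∈ allV k
∈-allV []                = here refl
∈-allV {suc k} (true ∷ v)  = ∈-++⁺ˡ (∈-map⁺ (true ∷_) (∈-allV v))
∈-allV {suc k} (false ∷ v) = ∈-++⁺ʳ (map (true ∷_) (allV k)) (∈-map⁺ (false ∷_) (∈-allV v))

Mask : Set
Mask = ℕ → Bool

infixr 5 _◂_
_◂_ : Bool → Mask → Mask
(b ◂ m) zero    = b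
(b ◂ m) (suc i) = m i

maskSum : ∀ {r} → List (V r) → Mask → V r
maskSum []      m = 𝟘
maskSum (x ∷ L) m = m 0 · x ⊕ maskSum L (m ∘ suc)

maskSum-xor : ∀ {r} (L : List (V r)) m m' →
              maskSum L (λ i → m i xor m' i) ≡ maskSum L m ⊕ maskSum L m'
maskSum-xor []      m m' = sym (⊕-self 𝟘)
maskSum-xor (x ∷ L) m m' = begin
  (m 0 xor m' 0) · x ⊕ maskSum L (λ i → m (suc i) xor m' (suc i))
    ≡⟨ cong₂ _⊕_ (·-distribʳ-xor (m 0) (m' 0) x) (maskSum-xor L (m ∘ suc) (m' ∘ suc)) ⟩
  (m 0 · x ⊕ m' 0 · x) ⊕ (maskSum L (m ∘ suc) ⊕ maskSum L (m' ∘ suc))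
    ≡⟨ ⊕-interchange _ _ _ _ ⟩
  (m 0 · x ⊕ maskSum L (m ∘ suc)) ⊕ (m' 0 · x ⊕ maskSum L (m' ∘ suc))
    ∎

maskSum-false : ∀ {r} (L : List (V r)) → maskSum L (λ _ → false) ≡ 𝟘
maskSum-false []      = refl
maskSum-false (x ∷ L) = trans (⊕-identityˡ _) (maskSum-false L)

record Span {r} (L : List (V r)) (v : V r) : Set where
  constructor mask
  field
    bits : Mask
    sums : maskSum L bits ≡ v

infix 4 _≡_[mod_]
_≡_[mod_] : ∀ {r} → V r → V r → List (V r) → Set
x ≡ y [mod C ] = Span C (x ⊕ y)

module _ {r : ℕ} where

  span-𝟘 : (L : List (V r)) → Span L 𝟘
  span-𝟘 L = mask (λ _ → false) (maskSum-false L)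

  span-⊕ : (L : List (V r)) {v w : V r} → Span L v → Span L w → Span L (v ⊕ w)
  span-⊕ L (mask m refl) (mask m' refl) = mask (λ i → m i xor m' i) (maskSum-xor L m m')

  span-∈ : {L : List (V r)} {x : V r} → x ∈ L → Span L x
  span-∈ {y ∷ L} (here refl) = mask (true ◂ λ _ → false) (trans (cong (y ⊕_) (maskSum-false L)) (⊕-identityʳ y))
  span-∈ {y ∷ L} (there p) with span-∈ p
  ... | mask m e = mask (false ◂ m) (trans (⊕-identityˡ _) e)

  span-∷ : (x : V r) (L : List (V r)) {v : V r} → Span L v → Span (x ∷ L) v
  span-∷ x L (mask m e) = mask (false ◂ m) (trans (⊕-identityˡ _) e)

  span-∷⁻ : (x : V r) (L : List (V r)) {v : V r} → Span (x ∷ L) v → Span L v ⊎ Span L (x ⊕ v)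
  span-∷⁻ x L (mask m refl) with m 0
  ... | false = inj₁ (mask (m ∘ suc) (sym (⊕-identityˡ _)))
  ... | true  = inj₂ (mask (m ∘ suc) (sym (⊕-cancelˡ x _)))

  span-[] : {v : V r} → Span [] v → v ≡ 𝟘
  span-[] (mask m e) = sym e

  span? : (L : List (V r)) (v : V r) → Dec (Span L v)
  span? []      v with v ≟V 𝟘
  ... | yes refl = yes (span-𝟘 [])
  ... | no  v≢𝟘  = no (λ s → v≢𝟘 (span-[] s))
  span? (x ∷ L) v with span? L v | span? L (x ⊕ v)
  ... | yes s | _     = yes (span-∷ x L s)
  ... | no  _ | yes s =
    yes (subst (Span (x ∷ L)) (⊕-cancelˡ x v) (span-⊕ (x ∷ L) (span-∈ {L = x ∷ L} (here refl)) (span-∷ x L s)))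
  ... | no ¬s | no ¬t = no λ s → [ ¬s , ¬t ]′ (span-∷⁻ x L s)

  span-ind : (L : List (V r)) (P : V r → Set) → P 𝟘 → (∀ {v w} → P v → P w → P (v ⊕ w)) →
             (∀ {x} → x ∈ L → P x) → ∀ {v} → Span L v → P v
  span-ind L P P𝟘 P⊕ PL (mask m refl) = go L m PL
    where
    go : ∀ L m → (∀ {x} → x ∈ L → P x) → P (maskSum L m)
    go []      m _  = P𝟘
    go (x ∷ L) m PL = P⊕ (P· (m 0)) (go L (m ∘ suc) (PL ∘ there))
      where
      P· : ∀ b → P (b · x)
      P· true  = PL (here refl)
      P· false = P𝟘

  span-mono : {L L' : List (V r)} → (∀ {x} → x ∈ L → Span L' x) → ∀ {v} → Span L v → Span L' v
  span-mono {L} {L'} = span-ind L (Span L') (span-𝟘 L') (span-⊕ L')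

  span-≡𝟘 : (L : List (V r)) {v : V r} → v ≡ 𝟘 → Span L v
  span-≡𝟘 L refl = span-𝟘 L

  span-sumV : (L : List (V r)) → Span L (sumV L)
  span-sumV []      = span-𝟘 []
  span-sumV (x ∷ L) with span-sumV L
  ... | mask m e = mask (true ◂ m) (cong (x ⊕_) e)

  span-pair : {p q v : V r} → Span (p ∷ q ∷ []) v → v ≡ 𝟘 ⊎ v ≡ p ⊎ v ≡ q ⊎ v ≡ p ⊕ q
  span-pair {p} {q} (mask m refl) with m 0 | m 1
  ... | false | false = inj₁ (solve 0 (id ⊞ (id ⊞ id) ⊜ id) refl)
  ... | true  | false = inj₂ (inj₁ (solve 1 (λ p → p ⊞ (id ⊞ id) ⊜ p) refl p))
  ... | false | true  = inj₂ (inj₂ (inj₁ (solve 1 (λ q → id ⊞ (q ⊞ id) ⊜ q) refl q)))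
  ... | true  | true  = inj₂ (inj₂ (inj₂ (solve 2 (λ p q → p ⊞ (q ⊞ id) ⊜ p ⊞ q) refl p q)))

  span-sumV-⊆ : {L K : List (V r)} → All (_∈ L) K → Span L (sumV K)
  span-sumV-⊆ {L} []         = span-𝟘 L
  span-sumV-⊆ {L} (p ∷ K⊆L) = span-⊕ L (span-∈ p) (span-sumV-⊆ K⊆L)

  span-subtract : (L : List (V r)) {x y : V r} → Span L x → Span L (x ⊕ y) → Span L y
  span-subtract L {x} {y} sx sxy = subst (Span L) (⊕-cancelˡ x y) (span-⊕ L sx sxy)

  span-++⁻ : (K K' : List (V r)) {v : V r} → Span (K ++ K') v →
             Σ (V r) λ w → Σ (V r) λ w' → Span K w × Span K' w' × w ⊕ w' ≡ v
  span-++⁻ K K' (mask m refl) = _ , _ , mask m refl , mask (λ i → m (length K + i)) refl , sym (maskSum-++ K m)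
    where
    maskSum-++ : ∀ K m → maskSum (K ++ K') m ≡ maskSum K m ⊕ maskSum K' (λ i → m (length K + i))
    maskSum-++ []      m = sym (⊕-identityˡ _)
    maskSum-++ (x ∷ K) m = trans (cong (m 0 · x ⊕_) (maskSum-++ K (m ∘ suc))) (sym (⊕-assoc _ _ _))

  mod-trans : {C : List (V r)} {x y z : V r} → x ≡ y [mod C ] → y ≡ z [mod C ] → x ≡ z [mod C ]
  mod-trans {C} {x} {y} {z} s t =
    subst (Span C) (solve 3 (λ x y z → (x ⊞ y) ⊞ (y ⊞ z) ⊜ x ⊞ z) refl x y z) (span-⊕ C s t)

  mod-sym : {C : List (V r)} {x y : V r} → x ≡ y [mod C ] → y ≡ x [mod C ]
  mod-sym {C} {x} {y} = subst (Span C) (⊕-comm x y)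

  mod-refl : {C : List (V r)} {x y : V r} → x ≡ y → x ≡ y [mod C ]
  mod-refl {C} x≡y = subst (Span C) (sym (≡⇒⊕≡𝟘 x≡y)) (span-𝟘 C)

  mod-⊕ : {C : List (V r)} {x y x' y' : V r} → x ≡ y [mod C ] → x' ≡ y' [mod C ] → x ⊕ x' ≡ y ⊕ y' [mod C ]
  mod-⊕ {C} {x} {y} {x'} {y'} s t = subst (Span C) (⊕-interchange x y x' y') (span-⊕ C s t)

  mod-𝟘 : {C : List (V r)} {x : V r} → Span C x → x ≡ 𝟘 [mod C ]
  mod-𝟘 {C} {x} = subst (Span C) (sym (⊕-identityʳ x))

  nonzeros : List (V r) → List (V r)
  nonzeros = filter (λ v → ¬? (v ≟V 𝟘))

  span-nonzeros⁻ : ∀ {L v} → Span (nonzeros L) v → Span L v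
  span-nonzeros⁻ = span-mono (λ m → span-∈ (proj₁ (∈-filter⁻ (λ v → ¬? (v ≟V 𝟘)) m)))

  span-nonzeros⁺ : ∀ {L v} → Span L v → Span (nonzeros L) v
  span-nonzeros⁺ {L} = span-mono include
    where
    include : ∀ {x} → x ∈ L → Span (nonzeros L) x
    include {x} m with x ≟V 𝟘
    ... | yes x≡𝟘 = span-≡𝟘 _ x≡𝟘
    ... | no  x≢𝟘 = span-∈ (∈-filter⁺ (λ v → ¬? (v ≟V 𝟘)) m x≢𝟘)

  All-nonzeros : ∀ {P : V r → Set} {L} → All (λ x → x ≢ 𝟘 → P x) L → All P (nonzeros L)
  All-nonzeros a = All.tabulate λ m → let (m' , x≢𝟘) = ∈-filter⁻ (λ v → ¬? (v ≟V 𝟘)) m in All.lookup a m' x≢𝟘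

module _ {A : Set} where

  select : List A → Mask → List A
  select []      m = []
  select (x ∷ L) m = if m 0 then x ∷ select L (m ∘ suc) else select L (m ∘ suc)

  reject : List A → Mask → List A
  reject []      m = []
  reject (x ∷ L) m = if m 0 then reject L (m ∘ suc) else x ∷ reject L (m ∘ suc)

  select-⊆ : ∀ L m {x} → x ∈ select L m → x ∈ L
  select-⊆ (y ∷ L) m p with m 0
  select-⊆ (y ∷ L) m (here e)  | true  = here e
  select-⊆ (y ∷ L) m (there p) | true  = there (select-⊆ L (m ∘ suc) p)
  select-⊆ (y ∷ L) m p         | false = there (select-⊆ L (m ∘ suc) p)

  reject-⊆ : ∀ L m {x} → x ∈ reject L m → x ∈ L
  reject-⊆ (y ∷ L) m p with m 0
  reject-⊆ (y ∷ L) m p         | true  = there (reject-⊆ L (m ∘ suc) p)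
  reject-⊆ (y ∷ L) m (here e)  | false = here e
  reject-⊆ (y ∷ L) m (there p) | false = there (reject-⊆ L (m ∘ suc) p)

  length-select : ∀ L m → length (select L m) ≤ length L
  length-select []      m = z≤n
  length-select (x ∷ L) m with m 0
  ... | true  = s≤s (length-select L (m ∘ suc))
  ... | false = ℕₚ.m≤n⇒m≤1+n (length-select L (m ∘ suc))

  length-reject : ∀ L m → length (reject L m) ≤ length L
  length-reject []      m = z≤n
  length-reject (x ∷ L) m with m 0
  ... | true  = ℕₚ.m≤n⇒m≤1+n (length-reject L (m ∘ suc))
  ... | false = s≤s (length-reject L (m ∘ suc))

  select-all-or-shorter : ∀ L m → reject L m ≡ [] ⊎ suc (length (select L m)) ≤ length L
  select-all-or-shorter []      m = inj₁ refl
  select-all-or-shorter (x ∷ L) m with m 0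
  ... | false = inj₂ (s≤s (length-select L (m ∘ suc)))
  ... | true  with select-all-or-shorter L (m ∘ suc)
  ...   | inj₁ e  = inj₁ e
  ...   | inj₂ lt = inj₂ (s≤s lt)

module _ {A B : Set} (f : A → B) where

  map-select : ∀ L m → map f (select L m) ≡ select (map f L) m
  map-select []      m = refl
  map-select (x ∷ L) m with m 0
  ... | true  = cong (f x ∷_) (map-select L (m ∘ suc))
  ... | false = map-select L (m ∘ suc)

  map-reject : ∀ L m → map f (reject L m) ≡ reject (map f L) m
  map-reject []      m = refl
  map-reject (x ∷ L) m with m 0
  ... | true  = map-reject L (m ∘ suc)
  ... | false = cong (f x ∷_) (map-reject L (m ∘ suc))

module _ {r : ℕ} where

  sumV-select : (L : List (V r)) (m : Mask) → sumV (select L m) ≡ maskSum L m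
  sumV-select []      m = refl
  sumV-select (x ∷ L) m with m 0
  ... | true  = cong (x ⊕_) (sumV-select L (m ∘ suc))
  ... | false = trans (sumV-select L (m ∘ suc)) (sym (⊕-identityˡ _))

  sumV-select-reject : (L : List (V r)) (m : Mask) → sumV L ≡ sumV (select L m) ⊕ sumV (reject L m)
  sumV-select-reject []      m = sym (⊕-self 𝟘)
  sumV-select-reject (x ∷ L) m with m 0
  ... | true  = trans (cong (x ⊕_) (sumV-select-reject L (m ∘ suc))) (sym (⊕-assoc x _ _))
  ... | false = trans (cong (x ⊕_) (sumV-select-reject L (m ∘ suc)))
                      (solve 3 (λ x s t → x ⊞ (s ⊞ t) ⊜ s ⊞ (x ⊞ t)) refl x _ _)

module _ {r r'} {φ : V r → V r'} (lin : Linear φ) where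

  linear-𝟘 : φ 𝟘 ≡ 𝟘
  linear-𝟘 = begin
    φ 𝟘               ≡⟨ cong φ (⊕-self 𝟘) ⟨
    φ (𝟘 ⊕ 𝟘)         ≡⟨ lin 𝟘 𝟘 ⟩
    φ 𝟘 ⊕ φ 𝟘         ≡⟨ ⊕-self (φ 𝟘) ⟩
    𝟘                 ∎

  linear-· : ∀ b x → φ (b · x) ≡ b · φ x
  linear-· true  x = refl
  linear-· false x = linear-𝟘

  linear-maskSum : ∀ L m → φ (maskSum L m) ≡ maskSum (map φ L) m
  linear-maskSum []      m = linear-𝟘
  linear-maskSum (x ∷ L) m = trans (lin _ _) (cong₂ _⊕_ (linear-· (m 0) x) (linear-maskSum L (m ∘ suc)))

  linear-sumV : ∀ L → φ (sumV L) ≡ sumV (map φ L)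
  linear-sumV []      = linear-𝟘
  linear-sumV (x ∷ L) = trans (lin x _) (cong (φ x ⊕_) (linear-sumV L))

  span-map : ∀ L {v} → Span L v → Span (map φ L) (φ v)
  span-map L (mask m refl) = mask m (sym (linear-maskSum L m))

  span-map⁻ : ∀ L {w} → Span (map φ L) w → Σ (V r) λ v → Span L v × φ v ≡ w
  span-map⁻ L (mask m refl) = maskSum L m , mask m refl , linear-maskSum L m

  mod-map : ∀ {C x y} → x ≡ y [mod C ] → φ x ≡ φ y [mod map φ C ]
  mod-map {C} {x} {y} s = subst (Span (map φ C)) (lin x y) (span-map C s)

  module _ {e : V r} (ker : KernelIs φ e) where

    fibre : ∀ {s v} → φ s ≡ φ v → v ≡ s ⊎ v ≡ e ⊕ s
    fibre {s} {v} φs≡φv with to (ker (s ⊕ v)) (trans (lin s v) (≡⇒⊕≡𝟘 φs≡φv))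
    ... | inj₁ s⊕v≡𝟘 = inj₁ (sym (⊕≡𝟘⇒≡ s⊕v≡𝟘))
    ... | inj₂ s⊕v≡e = inj₂ (trans (sym (⊕-cancelˡ s v)) (trans (cong (s ⊕_) s⊕v≡e) (⊕-comm s e)))

    span-map-kernel : ∀ L {v} → Span (map φ L) (φ v) → Span L v ⊎ Span L (e ⊕ v)
    span-map-kernel L {v} sp with span-map⁻ L sp
    ... | s , ss , φs≡φv with fibre φs≡φv
    ...   | inj₁ refl = inj₁ ss
    ...   | inj₂ refl = inj₂ (subst (Span L) (sym (⊕-cancelˡ e s)) ss)

    span-lift : ∀ L {v} → Span (map φ L) (φ v) → Span (e ∷ L) v
    span-lift L {v} sp with span-map-kernel L sp
    ... | inj₁ s = span-∷ e L s
    ... | inj₂ s = subst (Span (e ∷ L)) (⊕-cancelˡ e v) (span-⊕ (e ∷ L) (span-∈ {L = e ∷ L} (here refl)) (span-∷ e L s))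

    span-lower : ∀ L {v} → Span (e ∷ L) v → Span (map φ L) (φ v)
    span-lower L {v} sp with span-∷⁻ (φ e) (map φ L) (span-map (e ∷ L) sp)
    ... | inj₁ s = s
    ... | inj₂ s = subst (Span (map φ L)) (trans (cong (_⊕ φ v) (from (ker e) (inj₂ refl))) (⊕-identityˡ _)) s

    mod-lift : ∀ L {x y} → φ x ≡ φ y [mod map φ L ] → x ≡ y [mod e ∷ L ]
    mod-lift L {x} {y} s = span-lift L (subst (Span (map φ L)) (sym (lin x y)) s)

module Elimination {r} (c : V r) (c≢𝟘 : c ≢ 𝟘) where

  private
    pivot : ∀ {r} (c : V r) → c ≢ 𝟘 → Σ (Fin r) λ i → lookup c i ≡ true
    pivot []          c≢𝟘 = ⊥-elim (c≢𝟘 refl)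
    pivot (true  ∷ c) _   = zero , refl
    pivot (false ∷ c) c≢𝟘 with pivot c (c≢𝟘 ∘ cong (false ∷_))
    ... | i , cᵢ≡1 = suc i , cᵢ≡1

    i : Fin r
    i = proj₁ (pivot c c≢𝟘)

  -- Adding c wherever the pivot coordinate i of c is set clears that
  -- coordinate, so the kernel is {0, c}.
  eliminate : V r → V r
  eliminate v = v ⊕ lookup v i · c

  eliminate-linear : Linear eliminate
  eliminate-linear u v = begin
    (u ⊕ v) ⊕ lookup (u ⊕ v) i · c              ≡⟨ cong (λ β → (u ⊕ v) ⊕ β · c) (Vecₚ.lookup-zipWith _xor_ i u v) ⟩
    (u ⊕ v) ⊕ (lookup u i xor lookup v i) · c   ≡⟨ cong ((u ⊕ v) ⊕_) (·-distribʳ-xor (lookup u i) (lookup v i) c) ⟩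
    (u ⊕ v) ⊕ (lookup u i · c ⊕ lookup v i · c) ≡⟨ ⊕-interchange u v _ _ ⟩
    (u ⊕ lookup u i · c) ⊕ (v ⊕ lookup v i · c) ∎

  eliminate-kernel : KernelIs eliminate c
  eliminate-kernel v = mk⇔ kernel⊆ ⊆kernel
    where
    kernel⊆ : eliminate v ≡ 𝟘 → v ≡ 𝟘 ⊎ v ≡ c
    kernel⊆ e with lookup v i | ⊕≡𝟘⇒≡ e
    ... | true  | v≡c = inj₂ v≡c
    ... | false | v≡𝟘 = inj₁ v≡𝟘
    ⊆kernel : v ≡ 𝟘 ⊎ v ≡ c → eliminate v ≡ 𝟘
    ⊆kernel (inj₁ refl) = trans (cong (λ β → 𝟘 ⊕ β · c) (Vecₚ.lookup-replicate i false)) (⊕-self 𝟘)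
    ⊆kernel (inj₂ refl) = trans (cong (λ β → c ⊕ β · c) (proj₂ (pivot c c≢𝟘))) (⊕-self c)

module _ {r : ℕ} where

  sumV-++ : (K K' : List (V r)) → sumV (K ++ K') ≡ sumV K ⊕ sumV K'
  sumV-++ []      K' = sym (⊕-identityˡ _)
  sumV-++ (k ∷ K) K' = trans (cong (k ⊕_) (sumV-++ K K')) (sym (⊕-assoc k _ _))

  inSpan-𝟘 : (X : Subset r) → InSpan X 𝟘
  inSpan-𝟘 X = [] , [] , refl

  inSpan-⊕ : (X : Subset r) {v w : V r} → InSpan X v → InSpan X w → InSpan X (v ⊕ w)
  inSpan-⊕ X (K , a , refl) (K' , a' , refl) = K ++ K' , Allₚ.++⁺ a a' , sumV-++ K K'

  inSpan-∈ : (X : Subset r) {v : V r} → X v → InSpan X v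
  inSpan-∈ X {v} x = v ∷ [] , x ∷ [] , ⊕-identityʳ v

  inSpan-ind : (X : Subset r) (P : V r → Set) → P 𝟘 → (∀ {v w} → P v → P w → P (v ⊕ w)) →
               (∀ v → X v → P v) → ∀ {v} → InSpan X v → P v
  inSpan-ind X P P𝟘 P⊕ PX ([]    , []     , refl) = P𝟘
  inSpan-ind X P P𝟘 P⊕ PX (k ∷ K , xk ∷ a , refl) = P⊕ (PX k xk) (inSpan-ind X P P𝟘 P⊕ PX (K , a , refl))

  inSpan-mono : (X Y : Subset r) → (∀ v → X v → InSpan Y v) → ∀ {v} → InSpan X v → InSpan Y v
  inSpan-mono X Y = inSpan-ind X (InSpan Y) (inSpan-𝟘 Y) (inSpan-⊕ Y)

  span⇒inSpan : (X : Subset r) (L : List (V r)) → All X L → ∀ {v} → Span L v → InSpan X v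
  span⇒inSpan X L a = span-ind L (InSpan X) (inSpan-𝟘 X) (inSpan-⊕ X) (λ p → inSpan-∈ X (All.lookup a p))

  inSpan⇒span : (X : Subset r) (L : List (V r)) → (∀ v → X v → Span L v) → ∀ {v} → InSpan X v → Span L v
  inSpan⇒span X L = inSpan-ind X (Span L) (span-𝟘 L) (span-⊕ L)

inSpan-map : ∀ {r r'} {φ : V r → V r'} → Linear φ → (X : Subset r) (Y : Subset r') →
             (∀ v → X v → InSpan Y (φ v)) → ∀ {v} → InSpan X v → InSpan Y (φ v)
inSpan-map {φ = φ} lin X Y = inSpan-ind X (InSpan Y ∘ φ)
  (subst (InSpan Y) (sym (linear-𝟘 lin)) (inSpan-𝟘 Y))
  (λ {v} {w} p q → subst (InSpan Y) (sym (lin v w)) (inSpan-⊕ Y p q))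

inSpan-img⁻ : ∀ {r r'} {φ : V r → V r'} → Linear φ → (X : Subset r) →
              ∀ {w} → InSpan (img φ X) w → Σ (V r) λ s → InSpan X s × φ s ≡ w
inSpan-img⁻ {φ = φ} lin X = inSpan-ind (img φ X) (λ w → Σ (V _) λ s → InSpan X s × φ s ≡ w)
  (𝟘 , inSpan-𝟘 X , linear-𝟘 lin)
  (λ (s , Xs , e) (s' , Xs' , e') → s ⊕ s' , inSpan-⊕ X Xs Xs' , trans (lin s s') (cong₂ _⊕_ e e'))
  (λ w (u , Xu , e) → u , inSpan-∈ X Xu , e)

module _ {r : ℕ} (M : BinMat r) where

  pts-Flat : Flat M (pts M)
  pts-Flat = (λ v p → p) , (λ v p _ → p)

  closure-Flat : (Y : Subset r) → Flat M (λ v → pts M v × InSpan Y v)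
  closure-Flat Y = (λ v → proj₁) , λ v pv sp → pv , inSpan-mono _ Y (λ w → proj₂) sp

  span-Flat : (L : List (V r)) → Flat M (λ v → pts M v × Span L v)
  span-Flat L = (λ v → proj₁) , λ v pv sp → pv , inSpan⇒span _ L (λ w → proj₂) sp

  Flat-≐ : {X Y : Subset r} → Flat M X → X ⊆ Y → Y ⊆ X → Flat M Y
  Flat-≐ {X} {Y} (X⊆M , X-closed) X⊆Y Y⊆X =
    (λ v y → X⊆M v (Y⊆X v y)) ,
    (λ v pv sp → X⊆Y v (X-closed v pv (inSpan-mono Y X (λ w y → inSpan-∈ X (Y⊆X w y)) sp)))

  Flat-restrict : {F₀ F : Subset r} (fl : Flat M F₀) → Flat (restrict M F₀ (proj₁ fl)) F → Flat M F
  Flat-restrict {F₀} {F} (F₀⊆M , F₀-closed) (F⊆F₀ , F-closed) =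
    (λ v x → F₀⊆M v (F⊆F₀ v x)) ,
    (λ v pv sp → F-closed v (F₀-closed v pv (inSpan-mono F F₀ (λ w x → inSpan-∈ F₀ (F⊆F₀ w x)) sp)) sp)

preimage : ∀ {s r} → BinMat s → (V s → V r) → Subset r → Subset s
preimage N ι X x = pts N x × X (ι x)

span-image : ∀ {s r} {N : BinMat s} {M : BinMat r} {ι : V s → V r} →
             (∀ x → pts N x → pts M (ι x)) → (∀ X → Flat M X → Flat N (preimage N ι X)) →
             ∀ {L x} → All (pts N) L → pts N x → Span L x → Span (map ι L) (ι x)
span-image {N = N} {M} {ι} ι-pts preimage-Flat {L} {x} L⊆N px sp =
  proj₂ (proj₂ (proj₂ X-flat x px (span⇒inSpan _ L L⊆X sp)))
  where
  X-flat : Flat N (preimage N ι (λ v → pts M v × Span (map ι L) v))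
  X-flat = preimage-Flat _ (span-Flat M (map ι L))
  L⊆X : All (preimage N ι (λ v → pts M v × Span (map ι L) v)) L
  L⊆X = All.tabulate λ {y} y∈L → let py = All.lookup L⊆N y∈L in py , ι-pts y py , span-∈ (∈-map⁺ ι y∈L)

NonzeroMask : ∀ {r} → List (V r) → Mask → Set
NonzeroMask []      m = ⊥
NonzeroMask (x ∷ L) m = m 0 ≡ true ⊎ NonzeroMask L (m ∘ suc)

module _ {r : ℕ} where

  private
    removeAt : {x : V r} (K : List (V r)) → x ∈ K → List (V r)
    removeAt (k ∷ K) (here _)  = K
    removeAt (k ∷ K) (there p) = k ∷ removeAt K p

    sumV-removeAt : {x : V r} (K : List (V r)) (p : x ∈ K) → sumV K ≡ x ⊕ sumV (removeAt K p)
    sumV-removeAt (k ∷ K) (here refl) = refl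
    sumV-removeAt (k ∷ K) (there p) =
      trans (cong (k ⊕_) (sumV-removeAt K p)) (solve 3 (λ k x s → k ⊞ (x ⊞ s) ⊜ x ⊞ (k ⊞ s)) refl k _ _)

    All-removeAt : {x : V r} {P : V r → Set} (K : List (V r)) (p : x ∈ K) → All P K → All P (removeAt K p)
    All-removeAt (k ∷ K) (here _)  (_  ∷ a) = a
    All-removeAt (k ∷ K) (there p) (pk ∷ a) = pk ∷ All-removeAt K p a

    Unique-removeAt : {x : V r} (K : List (V r)) (p : x ∈ K) → Unique K → Unique (removeAt K p)
    Unique-removeAt (k ∷ K) (here _)  (_ ∷ u) = u
    Unique-removeAt (k ∷ K) (there p) (a ∷ u) = All-removeAt K p a ∷ Unique-removeAt K p u

    removeAt-∌ : {x : V r} (K : List (V r)) (p : x ∈ K) → Unique K → All (_≢ x) (removeAt K p)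
    removeAt-∌ (k ∷ K) (here refl) (a ∷ u) = All.map (λ k≢y y≡k → k≢y (sym y≡k)) a
    removeAt-∌ (k ∷ K) (there p)   (a ∷ u) = All.lookup a p ∷ removeAt-∌ K p u

    shrink : {x : V r} {L K : List (V r)} → All (_∈ x ∷ L) K → All (_≢ x) K → All (_∈ L) K
    shrink []             []          = []
    shrink (here e  ∷ a) (k≢x ∷ b)   = ⊥-elim (k≢x e)
    shrink (there q ∷ a) (k≢x ∷ b)   = q ∷ shrink a b

    ∉⇒All≢ : {x : V r} (K : List (V r)) → ¬ (x ∈ K) → All (_≢ x) K
    ∉⇒All≢ []      _   = []
    ∉⇒All≢ (k ∷ K) x∉K = (λ e → x∉K (here (sym e))) ∷ ∉⇒All≢ K (x∉K ∘ there)

    _∈?_ : (x : V r) (K : List (V r)) → Dec (x ∈ K)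
    x ∈? K = Data.List.Membership.DecPropositional._∈?_ _≟V_ x K

  unique-sum-maskSum : (L K : List (V r)) → Unique K → All (_∈ L) K →
                       Σ Mask λ m → maskSum L m ≡ sumV K × (K ≢ [] → NonzeroMask L m)
  unique-sum-maskSum []      []      u a        = (λ _ → false) , refl , λ K≢[] → K≢[] refl
  unique-sum-maskSum []      (k ∷ K) u (() ∷ a)
  unique-sum-maskSum (x ∷ L) K       u a with x ∈? K
  ... | yes p with unique-sum-maskSum L (removeAt K p) (Unique-removeAt K p u)
                     (shrink (All-removeAt K p a) (removeAt-∌ K p u))
  ...   | m , e , _ = (true ◂ m) , trans (cong (x ⊕_) e) (sym (sumV-removeAt K p)) , λ _ → inj₁ refl
  unique-sum-maskSum (x ∷ L) K u a | no x∉K with unique-sum-maskSum L K u (shrink a (∉⇒All≢ K x∉K))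
  ...   | m , e , nz = (false ◂ m) , trans (⊕-identityˡ _) e , λ K≢[] → inj₂ (nz K≢[])

  maskIndependent⇒LinIndep : (L : List (V r)) → (∀ m → NonzeroMask L m → maskSum L m ≢ 𝟘) → LinIndep (_∈ L)
  maskIndependent⇒LinIndep L indep K u a K≢[] sum≡𝟘 with unique-sum-maskSum L K u a
  ... | m , e , nz = indep m (nz K≢[]) (trans e sum≡𝟘)

  module _ {x y z : V r} (x≢𝟘 : x ≢ 𝟘) (y≢𝟘 : y ≢ 𝟘) (z≢𝟘 : z ≢ 𝟘) (x≢y : x ≢ y) (x≢z : x ≢ z) (y≢z : y ≢ z) where

    triangle-free⇒independent : (x ⊕ y) ⊕ z ≢ 𝟘 → LinIndep (_∈ x ∷ y ∷ z ∷ [])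
    triangle-free⇒independent xyz≢𝟘 = maskIndependent⇒LinIndep _ h
      where
      h : ∀ m → NonzeroMask (x ∷ y ∷ z ∷ []) m → maskSum (x ∷ y ∷ z ∷ []) m ≢ 𝟘
      h m nz with m 0 | m 1 | m 2
      h m (inj₁ ())               | false | false | false
      h m (inj₂ (inj₁ ()))        | false | false | false
      h m (inj₂ (inj₂ (inj₁ ()))) | false | false | false
      h m (inj₂ (inj₂ (inj₂ ()))) | false | false | false
      ... | true  | false | false = λ e → x≢𝟘 (trans (sym (solve 1 (λ a → a ⊞ (id ⊞ (id ⊞ id)) ⊜ a) refl x)) e)
      ... | false | true  | false = λ e → y≢𝟘 (trans (sym (solve 1 (λ a → id ⊞ (a ⊞ (id ⊞ id)) ⊜ a) refl y)) e)
      ... | false | false | true  = λ e → z≢𝟘 (trans (sym (solve 1 (λ a → id ⊞ (id ⊞ (a ⊞ id)) ⊜ a) refl z)) e)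
      ... | true  | true  | false = λ e → x≢y (⊕≡𝟘⇒≡ (trans (sym (solve 2 (λ a b → a ⊞ (b ⊞ (id ⊞ id)) ⊜ a ⊞ b) refl x y)) e))
      ... | true  | false | true  = λ e → x≢z (⊕≡𝟘⇒≡ (trans (sym (solve 2 (λ a b → a ⊞ (id ⊞ (b ⊞ id)) ⊜ a ⊞ b) refl x z)) e))
      ... | false | true  | true  = λ e → y≢z (⊕≡𝟘⇒≡ (trans (sym (solve 2 (λ a b → id ⊞ (a ⊞ (b ⊞ id)) ⊜ a ⊞ b) refl y z)) e))
      ... | true  | true  | true  = λ e → xyz≢𝟘 (trans (sym (solve 3 (λ a b c → a ⊞ (b ⊞ (c ⊞ id)) ⊜ (a ⊞ b) ⊞ c) refl x y z)) e)

    dependent⇒triangle : ¬ LinIndep (_∈ x ∷ y ∷ z ∷ []) → (x ⊕ y) ⊕ z ≡ 𝟘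
    dependent⇒triangle dep with (x ⊕ y) ⊕ z ≟V 𝟘
    ... | yes e = e
    ... | no  n = ⊥-elim (dep (triangle-free⇒independent n))

    triangle⇒dependent : (x ⊕ y) ⊕ z ≡ 𝟘 → ¬ LinIndep (_∈ x ∷ y ∷ z ∷ [])
    triangle⇒dependent e indep =
      indep (x ∷ y ∷ z ∷ []) ((x≢y ∷ x≢z ∷ []) ∷ (y≢z ∷ []) ∷ [] ∷ [])
            (here refl ∷ there (here refl) ∷ there (there (here refl)) ∷ []) (λ ())
            (trans (solve 3 (λ a b c → a ⊞ (b ⊞ (c ⊞ id)) ⊜ (a ⊞ b) ⊞ c) refl x y z) e)

LinIndep-⊆ : ∀ {r} {X Y : Subset r} → X ⊆ Y → LinIndep Y → LinIndep X
LinIndep-⊆ X⊆Y indep L u a = indep L u (All.map (λ {v} → X⊆Y v) a)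

All-img⁻ : ∀ {s r} {f : V s → V r} {X : Subset s} (L : List (V r)) → All (img f X) L →
           Σ (List (V s)) λ K → All X K × map f K ≡ L
All-img⁻ []      []                    = [] , [] , refl
All-img⁻ (_ ∷ L) ((u , Xu , refl) ∷ a) with All-img⁻ L a
... | K , XK , refl = u ∷ K , Xu ∷ XK , refl

module _ {s r} {f : V s → V r} (lin : Linear f) (inj : ∀ u v → f u ≡ f v → u ≡ v) where

  LinIndep-img : (X : Subset s) → LinIndep X ⇔ LinIndep (img f X)
  LinIndep-img X = mk⇔ forward backward
    where
    f-sumV : ∀ K → sumV (map f K) ≡ 𝟘 → sumV K ≡ 𝟘
    f-sumV K e = inj _ _ (trans (linear-sumV lin K) (trans e (sym (linear-𝟘 lin))))
    forward : LinIndep X → LinIndep (img f X)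
    forward indep L u a L≢[] sum≡𝟘 with All-img⁻ L a
    ... | K , XK , refl = indep K (Uniqueₚ.map⁻ u) XK (λ { refl → L≢[] refl }) (f-sumV K sum≡𝟘)
    backward : LinIndep (img f X) → LinIndep X
    backward indep []      u a K≢[] sum≡𝟘 = K≢[] refl
    backward indep (k ∷ K) u a K≢[] sum≡𝟘 =
      indep (map f (k ∷ K)) (Uniqueₚ.map⁺ (inj _ _) u) (Allₚ.map⁺ (All.map (λ {v} Xv → v , Xv , refl) a)) (λ ())
            (trans (sym (linear-sumV lin (k ∷ K))) (trans (cong f sum≡𝟘) (linear-𝟘 lin)))

module _ {s r} {N : BinMat s} {M : BinMat r} (I : Iso N M) where
  open Iso I

  iso-injective : ∀ {x y} → pts N x → pts N y → f x ≡ f y → x ≡ y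
  iso-injective {x} {y} px py e = trans (sym (gf x px)) (trans (cong g e) (gf y py))

  -- The triangle {x, y, x ⊕ y} is dependent, so its image is a triangle too.
  iso-additive : ∀ {x y} → pts N x → pts N y → pts N (x ⊕ y) → x ≢ y → f (x ⊕ y) ≡ f x ⊕ f y
  iso-additive {x} {y} px py pxy x≢y =
    sym (⊕≡𝟘⇒≡ (dependent⇒triangle (nz px) (nz py) (nz pxy) (f-≢ px py x≢y) (f-≢ px pxy x≢xy) (f-≢ py pxy y≢xy)
                                   image-dependent))
    where
    z : V s
    z = x ⊕ y
    nz : ∀ {w} → pts N w → f w ≢ 𝟘
    nz pw = nonzero M _ (f-pts _ pw)
    f-≢ : ∀ {v w} → pts N v → pts N w → v ≢ w → f v ≢ f w
    f-≢ pv pw v≢w e = v≢w (iso-injective pv pw e)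
    x≢xy : x ≢ z
    x≢xy e = nonzero N y py (⊕≡ˡ⇒≡𝟘 (sym e))
    y≢xy : y ≢ z
    y≢xy e = nonzero N x px (⊕≡ʳ⇒≡𝟘 (sym e))
    X : Subset s
    X v = v ∈ x ∷ y ∷ z ∷ []
    X⊆N : X ⊆ pts N
    X⊆N v (here refl)                 = px
    X⊆N v (there (here refl))         = py
    X⊆N v (there (there (here refl))) = pxy
    img⊆ : img f X ⊆ (_∈ f x ∷ f y ∷ f z ∷ [])
    img⊆ w (u , here refl , refl)                 = here refl
    img⊆ w (u , there (here refl) , refl)         = there (here refl)
    img⊆ w (u , there (there (here refl)) , refl) = there (there (here refl))
    image-dependent : ¬ LinIndep (_∈ f x ∷ f y ∷ f z ∷ [])
    image-dependent indep =
      triangle⇒dependent (nonzero N x px) (nonzero N y py) (nonzero N z pxy) x≢y x≢xy y≢xy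
        (⊕-self z)
        (proj₂ (from (Iso.indep I X X⊆N) ((λ { w (u , xu , refl) → f-pts u (X⊆N u xu) }) , LinIndep-⊆ img⊆ indep)))

𝟙 e₁ e₂ e₃ : V 3
𝟙  = true  ∷ true  ∷ true  ∷ []
e₁ = true  ∷ false ∷ false ∷ []
e₂ = false ∷ true  ∷ false ∷ []
e₃ = false ∷ false ∷ true  ∷ []

K4-cases : ∀ u → u ≡ 𝟘 ⊎ u ≡ 𝟙 ⊎ pts MK4 u
K4-cases u with u ≟V 𝟘 | u ≟V 𝟙
... | yes u≡𝟘 | _        = inj₁ u≡𝟘
... | no  _   | yes u≡𝟙  = inj₂ (inj₁ u≡𝟙)
... | no  u≢𝟘 | no  u≢𝟙  = inj₂ (inj₂ (u≢𝟘 , u≢𝟙))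

K4? : ∀ u → Dec (pts MK4 u)
K4? u = ¬? (u ≟V 𝟘) ×-dec ¬? (u ≟V 𝟙)

-- Membership of a concrete vector in M(K4), proved by evaluation.
◇ : ∀ {u} {_ : True (K4? u)} → pts MK4 u
◇ {_} {p} = toWitness p

module _ {r : ℕ} where

  comb : V r → V r → V r → V 3 → V r
  comb a b c (α ∷ β ∷ γ ∷ []) = (α · a ⊕ β · b) ⊕ γ · c

  comb-⊕ : ∀ a b c u v → comb a b c (u ⊕ v) ≡ comb a b c u ⊕ comb a b c v
  comb-⊕ a b c (α ∷ β ∷ γ ∷ []) (α' ∷ β' ∷ γ' ∷ []) = begin
    ((α xor α') · a ⊕ (β xor β') · b) ⊕ (γ xor γ') · c
      ≡⟨ cong₂ _⊕_ (cong₂ _⊕_ (·-distribʳ-xor α α' a) (·-distribʳ-xor β β' b)) (·-distribʳ-xor γ γ' c) ⟩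
    ((α · a ⊕ α' · a) ⊕ (β · b ⊕ β' · b)) ⊕ (γ · c ⊕ γ' · c)
      ≡⟨ solve 6 (λ A A' B B' C C' → ((A ⊞ A') ⊞ (B ⊞ B')) ⊞ (C ⊞ C') ⊜ ((A ⊞ B) ⊞ C) ⊞ ((A' ⊞ B') ⊞ C'))
               refl (α · a) (α' · a) (β · b) (β' · b) (γ · c) (γ' · c) ⟩
    ((α · a ⊕ β · b) ⊕ γ · c) ⊕ ((α' · a ⊕ β' · b) ⊕ γ' · c)
      ∎

  comb-e₁ : ∀ a b c → comb a b c e₁ ≡ a
  comb-e₁ a b c = solve 1 (λ a → (a ⊞ id) ⊞ id ⊜ a) refl a

  comb-e₂ : ∀ a b c → comb a b c e₂ ≡ b
  comb-e₂ a b c = solve 1 (λ b → (id ⊞ b) ⊞ id ⊜ b) refl b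

  comb-e₃ : ∀ a b c → comb a b c e₃ ≡ c
  comb-e₃ a b c = solve 1 (λ c → (id ⊞ id) ⊞ c ⊜ c) refl c

  comb-𝟘 : ∀ a b c → comb a b c 𝟘 ≡ 𝟘
  comb-𝟘 a b c = solve 0 ((id ⊞ id) ⊞ id ⊜ id) refl

  comb-mod : ∀ {C a b c a' b' c'} → a ≡ a' [mod C ] → b ≡ b' [mod C ] → c ≡ c' [mod C ] →
             ∀ u → comb a b c u ≡ comb a' b' c' u [mod C ]
  comb-mod {C} sa sb sc (α ∷ β ∷ γ ∷ []) = mod-⊕ (mod-⊕ (mod-· α sa) (mod-· β sb)) (mod-· γ sc)
    where
    mod-· : ∀ {x y} b → x ≡ y [mod C ] → b · x ≡ b · y [mod C ]
    mod-· true  s = s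
    mod-· false s = mod-refl refl

coefficients : V 3 → Mask
coefficients (α ∷ β ∷ γ ∷ []) = α ◂ β ◂ γ ◂ λ _ → false

comb-maskSum : ∀ {r} (a b c : V r) u → comb a b c u ≡ maskSum (a ∷ b ∷ c ∷ []) (coefficients u)
comb-maskSum a b c (α ∷ β ∷ γ ∷ []) = solve 3 (λ A B C → (A ⊞ B) ⊞ C ⊜ A ⊞ (B ⊞ (C ⊞ id))) refl (α · a) (β · b) (γ · c)

comb-map : ∀ {r r'} {φ : V r → V r'} → Linear φ → ∀ a b c u → φ (comb a b c u) ≡ comb (φ a) (φ b) (φ c) u
comb-map {φ = φ} lin a b c (α ∷ β ∷ γ ∷ []) =
  trans (lin _ _) (cong₂ _⊕_ (trans (lin _ _) (cong₂ _⊕_ (linear-· lin α a) (linear-· lin β b))) (linear-· lin γ c))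

TriangleClosed : (V 3 → Set) → Set
TriangleClosed X = ∀ {v w} → X v → X w → pts MK4 (v ⊕ w) → X (v ⊕ w)

module _ (X Y : V 3 → Set) (X-closed : TriangleClosed X) (Y-closed : TriangleClosed Y) where

  private
    closed-cancel : ∀ {Z} → TriangleClosed Z → ∀ {u v} → Z u → Z (u ⊕ v) → pts MK4 v → Z v
    closed-cancel {Z} cl {u} {v} zu zuv pv =
      subst Z (⊕-cancelˡ u v) (cl zu zuv (subst (pts MK4) (sym (⊕-cancelˡ u v)) pv))

    basis-spans : ∀ {Z} → TriangleClosed Z → Z e₁ → Z e₂ → Z e₃ → ∀ u → pts MK4 u → Z u
    basis-spans cl z₁ z₂ z₃ (false ∷ false ∷ false ∷ []) (u≢𝟘 , _) = ⊥-elim (u≢𝟘 refl)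
    basis-spans cl z₁ z₂ z₃ (true  ∷ true  ∷ true  ∷ []) (_ , u≢𝟙) = ⊥-elim (u≢𝟙 refl)
    basis-spans cl z₁ z₂ z₃ (true  ∷ false ∷ false ∷ []) _ = z₁
    basis-spans cl z₁ z₂ z₃ (false ∷ true  ∷ false ∷ []) _ = z₂
    basis-spans cl z₁ z₂ z₃ (false ∷ false ∷ true  ∷ []) _ = z₃
    basis-spans cl z₁ z₂ z₃ (true  ∷ true  ∷ false ∷ []) _ = cl z₁ z₂ ◇
    basis-spans cl z₁ z₂ z₃ (true  ∷ false ∷ true  ∷ []) _ = cl z₁ z₃ ◇
    basis-spans cl z₁ z₂ z₃ (false ∷ true  ∷ true  ∷ []) _ = cl z₂ z₃ ◇

    -- c is forced into Z unless a ⊕ c and b ⊕ c both lie in Z', which then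
    -- forces a and b into Z'.
    two-one : ∀ {Z Z'} → TriangleClosed Z → TriangleClosed Z' → (∀ u → pts MK4 u → Z u ⊎ Z' u) →
              ∀ {a b c} → Z a → Z b → Z' c → pts MK4 a → pts MK4 b → pts MK4 c →
              pts MK4 (a ⊕ c) → pts MK4 (b ⊕ c) → Z c ⊎ (Z' a × Z' b)
    two-one {Z} {Z'} cl cl' cover {a} {b} {c} za zb z'c pa pb pc pac pbc with cover (a ⊕ c) pac | cover (b ⊕ c) pbc
    ... | inj₁ zac  | _         = inj₁ (closed-cancel cl za zac pc)
    ... | inj₂ _    | inj₁ zbc  = inj₁ (closed-cancel cl zb zbc pc)
    ... | inj₂ z'ac | inj₂ z'bc = inj₂ (closed-cancel cl' z'c (subst Z' (⊕-comm a c) z'ac) pa ,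
                                        closed-cancel cl' z'c (subst Z' (⊕-comm b c) z'bc) pb)

  K4-monochromatic : (∀ u → pts MK4 u → X u ⊎ Y u) → (∀ u → pts MK4 u → X u) ⊎ (∀ u → pts MK4 u → Y u)
  K4-monochromatic cover
    with cover e₁ ◇ | cover e₂ ◇ | cover e₃ ◇
  ... | inj₁ x₁ | inj₁ x₂ | inj₁ x₃ = inj₁ (basis-spans X-closed x₁ x₂ x₃)
  ... | inj₂ y₁ | inj₂ y₂ | inj₂ y₃ = inj₂ (basis-spans Y-closed y₁ y₂ y₃)
  ... | inj₁ x₁ | inj₁ x₂ | inj₂ y₃ =
    [ (λ x₃ → inj₁ (basis-spans X-closed x₁ x₂ x₃)) , (λ (y₁ , y₂) → inj₂ (basis-spans Y-closed y₁ y₂ y₃)) ]′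
      (two-one X-closed Y-closed cover x₁ x₂ y₃ ◇ ◇ ◇ ◇ ◇)
  ... | inj₁ x₁ | inj₂ y₂ | inj₁ x₃ =
    [ (λ x₂ → inj₁ (basis-spans X-closed x₁ x₂ x₃)) , (λ (y₁ , y₃) → inj₂ (basis-spans Y-closed y₁ y₂ y₃)) ]′
      (two-one X-closed Y-closed cover x₁ x₃ y₂ ◇ ◇ ◇ ◇ ◇)
  ... | inj₂ y₁ | inj₁ x₂ | inj₁ x₃ =
    [ (λ x₁ → inj₁ (basis-spans X-closed x₁ x₂ x₃)) , (λ (y₂ , y₃) → inj₂ (basis-spans Y-closed y₁ y₂ y₃)) ]′
      (two-one X-closed Y-closed cover x₂ x₃ y₁ ◇ ◇ ◇ ◇ ◇)
  ... | inj₂ y₁ | inj₂ y₂ | inj₁ x₃ =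
    [ (λ y₃ → inj₂ (basis-spans Y-closed y₁ y₂ y₃)) , (λ (x₁ , x₂) → inj₁ (basis-spans X-closed x₁ x₂ x₃)) ]′
      (two-one Y-closed X-closed (λ u pu → Data.Sum.swap (cover u pu)) y₁ y₂ x₃ ◇ ◇ ◇ ◇ ◇)
  ... | inj₂ y₁ | inj₁ x₂ | inj₂ y₃ =
    [ (λ y₂ → inj₂ (basis-spans Y-closed y₁ y₂ y₃)) , (λ (x₁ , x₃) → inj₁ (basis-spans X-closed x₁ x₂ x₃)) ]′
      (two-one Y-closed X-closed (λ u pu → Data.Sum.swap (cover u pu)) y₁ y₃ x₂ ◇ ◇ ◇ ◇ ◇)
  ... | inj₁ x₁ | inj₂ y₂ | inj₂ y₃ =
    [ (λ y₁ → inj₂ (basis-spans Y-closed y₁ y₂ y₃)) , (λ (x₂ , x₃) → inj₁ (basis-spans X-closed x₁ x₂ x₃)) ]′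
      (two-one Y-closed X-closed (λ u pu → Data.Sum.swap (cover u pu)) y₂ y₃ x₁ ◇ ◇ ◇ ◇ ◇)

-- M(K4) as an induced minor

-- si((M|F)/C) ≅ M(K4), the point u ∈ GF(2)^3 ∖ {0, 𝟙} of M(K4) corresponding
-- to the class of point u modulo ⟨C⟩.
record K4Certificate {r} (M : BinMat r) : Set₁ where
  field
    F      : Subset r
    F-flat : Flat M F
    C      : List (V r)
    C⊆F    : All F C
    a b c  : V r

  point : V 3 → V r
  point = comb a b c

  field
    independent : ∀ u → Span C (point u) → u ≡ 𝟘
    covered     : ∀ y → F y → Σ (V 3) λ u → u ≢ 𝟙 × y ≡ point u [mod C ]
    realised    : ∀ u → pts MK4 u → Σ (V r) λ d → F d × d ≡ point u [mod C ]

  F⊆M : F ⊆ pts M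
  F⊆M = proj₁ F-flat

  RealisedIn : Subset r → V 3 → Set
  RealisedIn E u = Σ (V r) λ d → F d × E d × d ≡ point u [mod C ]

  point-injective : ∀ u v → point u ≡ point v → u ≡ v
  point-injective u v e = ⊕≡𝟘⇒≡ (independent (u ⊕ v) (span-≡𝟘 C (trans (comb-⊕ a b c u v) (≡⇒⊕≡𝟘 e))))

  Represented : V r → Set
  Represented v = Σ (V 3) λ u → v ≡ point u [mod C ]

  represented-unique : ∀ {x} u v → x ≡ point u [mod C ] → x ≡ point v [mod C ] → u ≡ v
  represented-unique u v s t =
    ⊕≡𝟘⇒≡ (independent (u ⊕ v) (subst (Span C) (sym (comb-⊕ a b c u v)) (mod-trans (mod-sym s) t)))

  represented? : ∀ v → Dec (Represented v)
  represented? v with Any.any? (λ u → span? C (v ⊕ point u)) (allV 3)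
  ... | yes p = yes (Any.satisfied p)
  ... | no ¬p = no (λ (u , s) → ¬p (lose (∈-allV u) s))

  F-avoids-𝟙 : ∀ {y} → F y → ¬ (y ≡ point 𝟙 [mod C ])
  F-avoids-𝟙 {y} Fy s with covered y Fy
  ... | u , u≢𝟙 , t = u≢𝟙 (represented-unique u 𝟙 t s)

  K4-point-inSpan : ∀ u → pts MK4 u → InSpan F (point u)
  K4-point-inSpan u pu with realised u pu
  ... | d , Fd , s = subst (InSpan F) (⊕-cancelˡ d (point u)) (inSpan-⊕ F (inSpan-∈ F Fd) (span⇒inSpan F C C⊆F s))

  point-inSpan : ∀ u → InSpan F (point u)
  point-inSpan u with K4-cases u
  ... | inj₁ refl        = subst (InSpan F) (sym (comb-𝟘 a b c)) (inSpan-𝟘 F)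
  ... | inj₂ (inj₂ pu)   = K4-point-inSpan u pu
  ... | inj₂ (inj₁ refl) = subst (InSpan F) (sym (comb-⊕ a b c e₁ e₂₃))
                             (inSpan-⊕ F (K4-point-inSpan e₁ ◇) (K4-point-inSpan e₂₃ ◇))
    where
    e₂₃ : V 3
    e₂₃ = false ∷ true ∷ true ∷ []

  represented-𝟘 : ∀ {v} → v ≡ point 𝟘 [mod C ] → Span C v
  represented-𝟘 {v} = subst (Span C) (trans (cong (v ⊕_) (comb-𝟘 a b c)) (⊕-identityʳ v))

  represented-inSpan : ∀ {v} → Represented v → InSpan F v
  represented-inSpan {v} (u , s) =
    subst (InSpan F) (⊕-cancelʳ (point u) v) (inSpan-⊕ F (span⇒inSpan F C C⊆F s) (point-inSpan u))

module FromIso {r} {M : BinMat r} (I : Iso MK4 M) where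

  private
    open Iso I
    point : V 3 → V r
    point = comb (f e₁) (f e₂) (f e₃)
    f≡point : ∀ u → pts MK4 u → f u ≡ point u
    f≡point (false ∷ false ∷ false ∷ []) (u≢𝟘 , _) = ⊥-elim (u≢𝟘 refl)
    f≡point (true  ∷ true  ∷ true  ∷ []) (_ , u≢𝟙) = ⊥-elim (u≢𝟙 refl)
    f≡point (true  ∷ false ∷ false ∷ []) _ = sym (comb-e₁ (f e₁) (f e₂) (f e₃))
    f≡point (false ∷ true  ∷ false ∷ []) _ = sym (comb-e₂ (f e₁) (f e₂) (f e₃))
    f≡point (false ∷ false ∷ true  ∷ []) _ = sym (comb-e₃ (f e₁) (f e₂) (f e₃))
    f≡point (true  ∷ true  ∷ false ∷ []) _ =
      trans (iso-additive I {e₁} {e₂} ◇ ◇ ◇ (λ ())) (solve 2 (λ a b → a ⊞ b ⊜ (a ⊞ b) ⊞ id) refl (f e₁) (f e₂))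
    f≡point (true  ∷ false ∷ true  ∷ []) _ =
      trans (iso-additive I {e₁} {e₃} ◇ ◇ ◇ (λ ())) (solve 2 (λ a c → a ⊞ c ⊜ (a ⊞ id) ⊞ c) refl (f e₁) (f e₃))
    f≡point (false ∷ true  ∷ true  ∷ []) _ =
      trans (iso-additive I {e₂} {e₃} ◇ ◇ ◇ (λ ())) (solve 2 (λ b c → b ⊞ c ⊜ (id ⊞ b) ⊞ c) refl (f e₂) (f e₃))
    independent : ∀ u → Span [] (point u) → u ≡ 𝟘
    independent u sp with K4-cases u
    ... | inj₁ u≡𝟘 = u≡𝟘
    ... | inj₂ (inj₁ refl) = ⊥-elim (e₁₂≢e₃ (iso-injective I ◇ ◇ (⊕≡𝟘⇒≡ f₁₂⊕f₃≡𝟘)))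
      where
      e₁₂≢e₃ : e₁ ⊕ e₂ ≢ e₃
      e₁₂≢e₃ ()
      f₁₂⊕f₃≡𝟘 : f (e₁ ⊕ e₂) ⊕ f e₃ ≡ 𝟘
      f₁₂⊕f₃≡𝟘 = trans (cong (_⊕ f e₃) (iso-additive I {e₁} {e₂} ◇ ◇ ◇ (λ ()))) (span-[] sp)
    ... | inj₂ (inj₂ pu) = ⊥-elim (nonzero M _ (f-pts u pu) (trans (f≡point u pu) (span-[] sp)))
    covered : ∀ y → pts M y → Σ (V 3) λ u → u ≢ 𝟙 × y ≡ point u [mod [] ]
    covered y py = g y , proj₂ (g-pts y py) , mod-refl (trans (sym (fg y py)) (f≡point (g y) (g-pts y py)))
    realised : ∀ u → pts MK4 u → Σ (V r) λ d → pts M d × d ≡ point u [mod [] ]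
    realised u pu = f u , f-pts u pu , mod-refl (f≡point u pu)

  certificate : K4Certificate M
  certificate = record
    { F = pts M ; F-flat = pts-Flat M ; C = [] ; C⊆F = []
    ; a = f e₁ ; b = f e₂ ; c = f e₃
    ; independent = independent ; covered = covered ; realised = realised }

restriction-certificate : ∀ {r} {M : BinMat r} {F₀} (fl : Flat M F₀) → K4Certificate (restrict M F₀ (proj₁ fl)) →
                          K4Certificate M
restriction-certificate {M = M} fl Q = record { K4Certificate Q ; F-flat = Flat-restrict M fl (K4Certificate.F-flat Q) }

module Contraction {r r'} {M : BinMat r} {e : V r} (pe : pts M e) {φ : V r → V r'} (lin : Linear φ)
                   (ker : KernelIs φ e) (Q : K4Certificate (contract M e φ ker)) where

  private
    module Q = K4Certificate Q
    F : Subset r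
    F v = pts M v × (v ≡ e ⊎ Q.F (φ v))

    lift-list : ∀ K → All Q.F K → Σ (List (V r)) λ L → All F L × map φ L ≡ K
    lift-list []      []          = [] , [] , refl
    lift-list (k ∷ K) (Fk ∷ K⊆F) with Q.F⊆M k Fk | lift-list K K⊆F
    ... | v , pv , _ , refl | L , L⊆F , refl = v ∷ L , (pv , inj₂ Fk) ∷ L⊆F , refl

    L : List (V r)
    L = proj₁ (lift-list Q.C Q.C⊆F)
    L⊆F : All F L
    L⊆F = proj₁ (proj₂ (lift-list Q.C Q.C⊆F))
    φL≡C : map φ L ≡ Q.C
    φL≡C = proj₂ (proj₂ (lift-list Q.C Q.C⊆F))

    lift : ∀ {x y} → φ x ≡ φ y [mod Q.C ] → x ≡ y [mod e ∷ L ]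
    lift s = mod-lift lin ker L (subst (λ K → _ ≡ _ [mod K ]) (sym φL≡C) s)

    lower : ∀ {v} → Span (e ∷ L) v → Span Q.C (φ v)
    lower s = subst (λ K → Span K _) φL≡C (span-lower lin ker L s)

    realise : ∀ u → pts MK4 u → Σ (V r) λ v → pts M v × Q.F (φ v) × φ v ≡ Q.point u [mod Q.C ]
    realise u pu with Q.realised u pu
    ... | d , Fd , s with Q.F⊆M d Fd
    ...   | v , pv , _ , refl = v , pv , Fd , s

    φ-realise : ∀ u pu → φ (proj₁ (realise u pu)) ≡ Q.point u [mod Q.C ]
    φ-realise u pu = proj₂ (proj₂ (proj₂ (realise u pu)))

    a b c : V r
    a = proj₁ (realise e₁ ◇)
    b = proj₁ (realise e₂ ◇)
    c = proj₁ (realise e₃ ◇)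

    point : V 3 → V r
    point = comb a b c

    φ-point : ∀ u → φ (point u) ≡ Q.point u [mod Q.C ]
    φ-point u = subst (λ w → w ≡ Q.point u [mod Q.C ]) (sym (comb-map lin a b c u)) (comb-mod φa φb φc u)
      where
      φa : φ a ≡ Q.a [mod Q.C ]
      φa = subst (λ w → φ a ≡ w [mod Q.C ]) (comb-e₁ Q.a Q.b Q.c) (φ-realise e₁ ◇)
      φb : φ b ≡ Q.b [mod Q.C ]
      φb = subst (λ w → φ b ≡ w [mod Q.C ]) (comb-e₂ Q.a Q.b Q.c) (φ-realise e₂ ◇)
      φc : φ c ≡ Q.c [mod Q.C ]
      φc = subst (λ w → φ c ≡ w [mod Q.C ]) (comb-e₃ Q.a Q.b Q.c) (φ-realise e₃ ◇)

    lift-point : ∀ {v} u → φ v ≡ Q.point u [mod Q.C ] → v ≡ point u [mod e ∷ L ]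
    lift-point u s = lift (mod-trans s (mod-sym (φ-point u)))

    independent : ∀ u → Span (e ∷ L) (point u) → u ≡ 𝟘
    independent u sp = Q.independent u (span-subtract Q.C (lower sp) (φ-point u))

    covered : ∀ y → F y → Σ (V 3) λ u → u ≢ 𝟙 × y ≡ point u [mod e ∷ L ]
    covered y (py , inj₁ refl) =
      𝟘 , (λ ()) , subst (λ w → y ≡ w [mod e ∷ L ]) (sym (comb-𝟘 a b c)) (mod-𝟘 (span-∈ {L = e ∷ L} (here refl)))
    covered y (py , inj₂ Fφy) with Q.covered (φ y) Fφy
    ... | u , u≢𝟙 , s = u , u≢𝟙 , lift-point u s

    realised : ∀ u → pts MK4 u → Σ (V r) λ d → F d × d ≡ point u [mod e ∷ L ]
    realised u pu with realise u pu
    ... | v , pv , Fφv , s = v , (pv , inj₂ Fφv) , lift-point u s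

    F-flat : Flat M F
    F-flat = (λ v → proj₁) , closed
      where
      φ-span : ∀ v → F v → InSpan Q.F (φ v)
      φ-span v (pv , inj₁ refl) = subst (InSpan Q.F) (sym (from (ker e) (inj₂ refl))) (inSpan-𝟘 Q.F)
      φ-span v (pv , inj₂ Fφv)  = inSpan-∈ Q.F Fφv
      closed : ∀ v → pts M v → InSpan F v → F v
      closed v pv sp with v ≟V e
      ... | yes v≡e = pv , inj₁ v≡e
      ... | no  v≢e = pv , inj₂ (proj₂ Q.F-flat (φ v) (v , pv , v≢e , refl) (inSpan-map lin F Q.F φ-span sp))

  certificate : K4Certificate M
  certificate = record
    { F = F ; F-flat = F-flat ; C = e ∷ L ; C⊆F = (pe , inj₁ refl) ∷ L⊆F
    ; a = a ; b = b ; c = c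
    ; independent = independent ; covered = covered ; realised = realised }

≼⇒certificate : ∀ {r} {M : BinMat r} → MK4 ≼ M → K4Certificate M
≼⇒certificate (iso I)                  = FromIso.certificate I
≼⇒certificate (restr F fl p)           = restriction-certificate fl (≼⇒certificate p)
≼⇒certificate (contr e pe φ lin ker p) = Contraction.certificate pe lin ker (≼⇒certificate p)

module _ {r} {M : BinMat r} (Q : K4Certificate M) (C≡[] : K4Certificate.C Q ≡ []) where
  open K4Certificate Q

  mod-[] : ∀ {x y} → x ≡ y [mod C ] → x ≡ y
  mod-[] s = ⊕≡𝟘⇒≡ (span-[] (subst (λ K → Span K _) C≡[] s))

  point∈F : ∀ u → pts MK4 u → F (point u)
  point∈F u pu with realised u pu
  ... | d , Fd , s = subst F (mod-[] s) Fd

  private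
    search : ∀ v → Dec (Any (λ u → point u ≡ v) (allV 3))
    search v = Any.any? (λ u → point u ≟V v) (allV 3)

    point⁻¹ : V r → V 3
    point⁻¹ v with search v
    ... | yes p = proj₁ (Any.satisfied p)
    ... | no  _ = 𝟘

    point-point⁻¹ : ∀ {v} u → point u ≡ v → point (point⁻¹ v) ≡ v
    point-point⁻¹ {v} u e with search v
    ... | yes p = proj₂ (Any.satisfied p)
    ... | no ¬p = ⊥-elim (¬p (lose (∈-allV u) e))

    point⁻¹-point : ∀ u → point⁻¹ (point u) ≡ u
    point⁻¹-point u = point-injective _ _ (point-point⁻¹ u refl)

    covered-point : ∀ v → F v → Σ (V 3) λ u → u ≢ 𝟙 × point u ≡ v
    covered-point v Fv with covered v Fv
    ... | u , u≢𝟙 , s = u , u≢𝟙 , sym (mod-[] s)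

    point⁻¹-in-K4 : ∀ v → F v → pts MK4 (point⁻¹ v)
    point⁻¹-in-K4 v Fv with covered-point v Fv
    ... | u , u≢𝟙 , refl =
      (λ e → nonzero M _ (F⊆M _ Fv) (trans (sym (cong point (point⁻¹-point u))) (trans (cong point e) (comb-𝟘 a b c)))) ,
      (λ e → u≢𝟙 (trans (sym (point⁻¹-point u)) e))

  base-iso : Iso MK4 (restrict M F F⊆M)
  base-iso = record
    { f = point ; g = point⁻¹ ; f-pts = point∈F ; g-pts = point⁻¹-in-K4
    ; gf = λ u _ → point⁻¹-point u
    ; fg = λ v Fv → let (u , _ , e) = covered-point v Fv in point-point⁻¹ u e
    ; indep = λ X X⊆K4 → mk⇔
        (λ (_ , indep) → (λ { v (u , Xu , refl) → point∈F u (X⊆K4 u Xu) }) ,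
                          to (LinIndep-img (comb-⊕ a b c) point-injective X) indep)
        (λ (_ , indep) → X⊆K4 , from (LinIndep-img (comb-⊕ a b c) point-injective X) indep) }

module _ {r} {M : BinMat r} (Q : K4Certificate M) {c₀ : V r} {C' : List (V r)}
         (C≡ : K4Certificate.C Q ≡ c₀ ∷ C') where
  open K4Certificate Q

  private
    Fc₀ : F c₀
    Fc₀ = All.head (subst (All F) C≡ C⊆F)

    pc₀ : pts M c₀
    pc₀ = F⊆M c₀ Fc₀

    open Elimination c₀ (nonzero M c₀ pc₀)
    φ : V r → V r
    φ = eliminate
    lin : Linear φ
    lin = eliminate-linear
    ker : KernelIs φ c₀
    ker = eliminate-kernel

    C'' : List (V r)
    C'' = nonzeros (map φ C')

    F' : Subset r
    F' = img φ (λ v → F v × v ≢ c₀)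

    point' : V 3 → V r
    point' = comb (φ a) (φ b) (φ c)

    lower : ∀ {x y} → x ≡ y [mod C ] → φ x ≡ φ y [mod C'' ]
    lower {x} {y} s =
      span-nonzeros⁺ (subst (Span (map φ C')) (lin x y) (span-lower lin ker C' (subst (λ K → Span K _) C≡ s)))

    lower-point : ∀ {v} u → v ≡ point u [mod C ] → φ v ≡ point' u [mod C'' ]
    lower-point {v} u s = subst (λ w → φ v ≡ w [mod C'' ]) (comb-map lin a b c u) (lower s)

    independent' : ∀ u → Span C'' (point' u) → u ≡ 𝟘
    independent' u sp = independent u (subst (λ K → Span K _) (sym C≡) (span-lift lin ker C' φ-span))
      where
      φ-span : Span (map φ C') (φ (point u))
      φ-span = span-nonzeros⁻ (subst (Span C'') (sym (comb-map lin a b c u)) sp)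

    covered' : ∀ y → F' y → Σ (V 3) λ u → u ≢ 𝟙 × y ≡ point' u [mod C'' ]
    covered' _ (v , (Fv , _) , refl) with covered v Fv
    ... | u , u≢𝟙 , s = u , u≢𝟙 , lower-point u s

    realised' : ∀ u → pts MK4 u → Σ (V r) λ d → F' d × d ≡ point' u [mod C'' ]
    realised' u pu@(u≢𝟘 , _) with realised u pu
    ... | d , Fd , s = φ d , (d , (Fd , d≢c₀) , refl) , lower-point u s
      where
      c₀∈⟨C⟩ : Span C c₀
      c₀∈⟨C⟩ = subst (λ K → Span K c₀) (sym C≡) (span-∈ {L = c₀ ∷ C'} (here refl))
      d≢c₀ : d ≢ c₀
      d≢c₀ refl = u≢𝟘 (independent u (span-subtract C c₀∈⟨C⟩ s))

    C''⊆F' : All F' C''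
    C''⊆F' = All-nonzeros (Allₚ.map⁺ (All.map C'-point (All.tail (subst (All F) C≡ C⊆F))))
      where
      C'-point : ∀ {v} → F v → φ v ≢ 𝟘 → F' (φ v)
      C'-point {v} Fv φv≢𝟘 = v , (Fv , λ { refl → φv≢𝟘 (from (ker c₀) (inj₂ refl)) }) , refl

    F'-flat : Flat (contract M c₀ φ ker) F'
    F'-flat = (λ { _ (v , (Fv , v≢c₀) , refl) → v , F⊆M v Fv , v≢c₀ , refl }) , closed
      where
      closed : ∀ w → contractPts M c₀ φ w → InSpan F' w → F' w
      closed _ (v , pv , v≢c₀ , refl) sp with inSpan-img⁻ lin _ sp
      ... | s , s∈⟨F∖c₀⟩ , φs≡φv = v , (proj₂ F-flat v pv v∈⟨F⟩ , v≢c₀) , refl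
        where
        s∈⟨F⟩ : InSpan F s
        s∈⟨F⟩ = inSpan-mono _ F (λ x p → inSpan-∈ F (proj₁ p)) s∈⟨F∖c₀⟩
        v∈⟨F⟩ : InSpan F v
        v∈⟨F⟩ with fibre lin ker φs≡φv
        ... | inj₁ refl = s∈⟨F⟩
        ... | inj₂ refl = inSpan-⊕ F (inSpan-∈ F Fc₀) s∈⟨F⟩

    eliminated : K4Certificate (contract M c₀ φ ker)
    eliminated = record
      { F = F' ; F-flat = F'-flat ; C = C'' ; C⊆F = C''⊆F' ; a = φ a ; b = φ b ; c = φ c
      ; independent = independent' ; covered = covered' ; realised = realised' }

  eliminate-first : (∀ {r'} {M' : BinMat r'} (Q' : K4Certificate M') → length (K4Certificate.C Q') ≤ length C' → MK4 ≼ M') →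
                    MK4 ≼ M
  eliminate-first shorter = contr c₀ pc₀ φ lin ker (shorter eliminated C''-length)
    where
    C''-length : length C'' ≤ length C'
    C''-length = ℕₚ.≤-trans (Listₚ.length-filter _ (map φ C')) (ℕₚ.≤-reflexive (Listₚ.length-map φ C'))

certificate⇒≼ : ∀ {r} {M : BinMat r} → K4Certificate M → MK4 ≼ M
certificate⇒≼ Q = by-length _ Q ℕₚ.≤-refl
  where
  by-length : ∀ n {r} {M : BinMat r} (Q : K4Certificate M) → length (K4Certificate.C Q) ≤ n → MK4 ≼ M
  by-length n Q _ with K4Certificate.C Q in C≡
  by-length n       Q _         | []      = restr _ (K4Certificate.F-flat Q) (iso (base-iso Q C≡))
  by-length (suc n) Q (s≤s len) | _ ∷ C' = eliminate-first Q C≡ (λ Q' len' → by-length n Q' (ℕₚ.≤-trans len' len))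

-- Conings

π : ∀ {r} → V (suc r) → V r
π (_ ∷ v) = v

π-linear : ∀ {r} → Linear (π {r})
π-linear (_ ∷ u) (_ ∷ v) = refl

apex : ∀ {r} → V (suc r)
apex = true ∷ 𝟘

π-kernel : ∀ {r} → KernelIs (π {r}) apex
π-kernel v = mk⇔ (kernel⊆ v) ⊆kernel
  where
  kernel⊆ : ∀ v → π v ≡ 𝟘 → v ≡ 𝟘 ⊎ v ≡ apex
  kernel⊆ (false ∷ v) refl = inj₁ refl
  kernel⊆ (true  ∷ v) refl = inj₂ refl
  ⊆kernel : ∀ {v} → v ≡ 𝟘 ⊎ v ≡ apex → π v ≡ 𝟘
  ⊆kernel (inj₁ refl) = refl
  ⊆kernel (inj₂ refl) = refl

module Coning {r} (N : BinMat r) (M : BinMat (suc r))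
  (up   : ∀ β t → pts N t → pts M (β ∷ t))
  (down : ∀ β t → pts M (β ∷ t) → t ≢ 𝟘 → pts N t)
  (Q : K4Certificate M) where
  open K4Certificate Q

  module Projection (apex-in-C : Represented apex → Span C apex) where

    private
      C' : List (V r)
      C' = nonzeros (map π C)

      F' : Subset r
      F' t = pts N t × img π F t

      lift : ∀ {v} → Represented v → Span C' (π v) → Span C v
      lift {v} (u , s) sp with span-map-kernel π-linear π-kernel C (span-nonzeros⁻ sp)
      ... | inj₁ v∈⟨C⟩ = v∈⟨C⟩
      ... | inj₂ apex⊕v∈⟨C⟩ = span-subtract C (apex-in-C (u , apex≡point)) apex⊕v∈⟨C⟩
        where
        apex≡point : apex ≡ point u [mod C ]
        apex≡point = subst (Span C) (solve 3 (λ p v w → (p ⊞ v) ⊞ (v ⊞ w) ⊜ p ⊞ w) refl apex v (point u))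
                           (span-⊕ C apex⊕v∈⟨C⟩ s)

      lower-point : ∀ {v} u → v ≡ point u [mod C ] → π v ≡ comb (π a) (π b) (π c) u [mod C' ]
      lower-point u s = span-nonzeros⁺ (subst (Span (map π C)) (cong (_ ⊕_) (comb-map π-linear a b c u))
                                              (mod-map π-linear s))

      independent' : ∀ u → Span C' (comb (π a) (π b) (π c) u) → u ≡ 𝟘
      independent' u sp =
        independent u (lift (u , mod-refl refl) (subst (Span C') (sym (comb-map π-linear a b c u)) sp))

      covered' : ∀ t → F' t → Σ (V 3) λ u → u ≢ 𝟙 × t ≡ comb (π a) (π b) (π c) u [mod C' ]
      covered' _ (_ , v , Fv , refl) with covered v Fv
      ... | u , u≢𝟙 , s = u , u≢𝟙 , lower-point u s

      realised' : ∀ u → pts MK4 u → Σ (V r) λ d → F' d × d ≡ comb (π a) (π b) (π c) u [mod C' ]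
      realised' u pu@(u≢𝟘 , _) with realised u pu
      ... | β ∷ t , Fd , s = t , (down β t (F⊆M _ Fd) t≢𝟘 , (β ∷ t) , Fd , refl) , lower-point u s
        where
        t≢𝟘 : t ≢ 𝟘
        t≢𝟘 t≡𝟘 = u≢𝟘 (independent u (span-subtract C (lift (u , s) (span-≡𝟘 C' t≡𝟘)) s))

      C'⊆F' : All F' C'
      C'⊆F' = All-nonzeros (Allₚ.map⁺ (All.map (λ { {β ∷ t} Fy t≢𝟘 → down β t (F⊆M _ Fy) t≢𝟘 , (β ∷ t) , Fy , refl }) C⊆F))

      F'-flat : Flat N F'
      F'-flat = (λ t → proj₁) , closed
        where
        closed : ∀ t → pts N t → InSpan F' t → F' t
        closed t pt sp with inSpan-img⁻ π-linear F (inSpan-mono F' (img π F) (λ w p → inSpan-∈ _ (proj₂ p)) sp)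
        ... | β ∷ _ , s∈⟨F⟩ , refl = pt , (β ∷ t) , proj₂ F-flat _ (up β t pt) s∈⟨F⟩ , refl

    certificate : K4Certificate N
    certificate = record
      { F = F' ; F-flat = F'-flat ; C = C' ; C⊆F = C'⊆F' ; a = π a ; b = π b ; c = π c
      ; independent = independent' ; covered = covered' ; realised = realised' }

  flip : ∀ {y} → pts M y → y ≢ apex → pts M (y ⊕ apex)
  flip {β ∷ t} py y≢apex with t ≟V 𝟘
  flip {false ∷ t} py y≢apex | yes refl = ⊥-elim (nonzero M _ py refl)
  flip {true  ∷ t} py y≢apex | yes refl = ⊥-elim (y≢apex refl)
  ... | no t≢𝟘 = up _ _ (subst (pts N) (sym (⊕-identityʳ t)) (down β t py t≢𝟘))

  -- Translating by the apex moves a realisation of u ⊕ 𝟙 onto 𝟙.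
  apex-not-K4 : ∀ u → pts MK4 u → ¬ (apex ≡ point u [mod C ])
  apex-not-K4 u (u≢𝟘 , u≢𝟙) s with realised (u ⊕ 𝟙) (u⊕𝟙≢𝟘 , u⊕𝟙≢𝟙)
    where
    u⊕𝟙≢𝟘 : u ⊕ 𝟙 ≢ 𝟘
    u⊕𝟙≢𝟘 e = u≢𝟙 (⊕≡𝟘⇒≡ e)
    u⊕𝟙≢𝟙 : u ⊕ 𝟙 ≢ 𝟙
    u⊕𝟙≢𝟙 e = u≢𝟘 (trans (⊕-move e) (⊕-self 𝟙))
  ... | d , Fd , t = F-avoids-𝟙 Fd⊕apex d⊕apex≡point𝟙
    where
    d⊕apex≡point𝟙 : d ⊕ apex ≡ point 𝟙 [mod C ]
    d⊕apex≡point𝟙 = subst (λ w → d ⊕ apex ≡ w [mod C ])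
      (trans (sym (comb-⊕ a b c (u ⊕ 𝟙) u)) (cong point (solve 2 (λ u o → (u ⊞ o) ⊞ u ⊜ o) refl u 𝟙)))
      (mod-⊕ t s)
    d≢apex : d ≢ apex
    d≢apex refl with represented-unique (u ⊕ 𝟙) u t s
    ... | u⊕𝟙≡u with trans (sym (⊕-cancelˡ u 𝟙)) (trans (cong (u ⊕_) u⊕𝟙≡u) (⊕-self u))
    ... | ()
    Fd⊕apex : F (d ⊕ apex)
    Fd⊕apex = proj₂ F-flat _ (flip (F⊆M d Fd) d≢apex)
                (inSpan-⊕ F (inSpan-∈ F Fd) (represented-inSpan (u , s)))

  project-unless-apex≡𝟙 : ¬ (apex ≡ point 𝟙 [mod C ]) → K4Certificate N
  project-unless-apex≡𝟙 apex≢𝟙 with represented? apex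
  ... | no ¬rep = Projection.certificate (⊥-elim ∘ ¬rep)
  ... | yes (u , s) with K4-cases u
  ...   | inj₁ refl        = Projection.certificate (λ _ → represented-𝟘 s)
  ...   | inj₂ (inj₁ refl) = ⊥-elim (apex≢𝟙 s)
  ...   | inj₂ (inj₂ pu)   = ⊥-elim (apex-not-K4 u pu s)

  C-avoids-apex≡𝟙 : ¬ pts M apex → apex ≡ point 𝟙 [mod C ] → ∀ {y} → y ∈ C → ⊥
  C-avoids-apex≡𝟙 apex∉M s {y} y∈C =
    F-avoids-𝟙 Fy⊕apex (subst (Span C) (sym (⊕-assoc y apex _)) (span-⊕ C (span-∈ y∈C) s))
    where
    Fy : F y
    Fy = All.lookup C⊆F y∈C
    Fy⊕apex : F (y ⊕ apex)
    Fy⊕apex = proj₂ F-flat _ (flip (F⊆M y Fy) (λ { refl → apex∉M (F⊆M y Fy) }))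
                (inSpan-⊕ F (inSpan-∈ F Fy) (represented-inSpan (𝟙 , s)))

cone-certificate : ∀ {r} (N : BinMat r) → K4Certificate (cone N) → K4Certificate N
cone-certificate N Q = project-unless-apex≡𝟙 λ s → F-avoids-𝟙 (proj₂ F-flat apex (inj₁ refl) (represented-inSpan (𝟙 , s))) s
  where
  up : ∀ β t → pts N t → conePts N (β ∷ t)
  up false t pt = pt
  up true  t pt = inj₂ pt
  down : ∀ β t → conePts N (β ∷ t) → t ≢ 𝟘 → pts N t
  down false t pt        _   = pt
  down true  t (inj₁ t≡𝟘) t≢𝟘 = ⊥-elim (t≢𝟘 t≡𝟘)
  down true  t (inj₂ pt) _   = pt
  open Coning N (cone N) up down Q
  open K4Certificate Q

tipless-certificate : ∀ {r} (N : BinMat r) → TriangleFree N → K4Certificate (tiplessCone N) → K4Certificate N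
tipless-certificate N triangle-free Q = project-unless-apex≡𝟙 apex≢𝟙
  where
  up : ∀ β t → pts N t → tiplessPts N (β ∷ t)
  up false t pt = pt
  up true  t pt = pt
  down : ∀ β t → tiplessPts N (β ∷ t) → pts N t
  down false t pt = pt
  down true  t pt = pt
  open Coning N (tiplessCone N) up (λ β t pt _ → down β t pt) Q
  open K4Certificate Q

  -- With C empty, the points of F realising e₁, e₂ and e₁ ⊕ e₂ project to a
  -- triangle of N.
  empty-C-triangle : C ≡ [] → apex ≡ point 𝟙 [mod C ] → ⊥
  empty-C-triangle C≡[] s = triangle-free (x e₁) (x e₂) (x e₁₂) (x∈N e₁ ◇) (x∈N e₂ ◇) (x∈N e₁₂ ◇)
    (x-injective e₁ e₂ (λ ()) (λ ())) (x-injective e₁ e₁₂ (λ ()) (λ ())) (x-injective e₂ e₁₂ (λ ()) (λ ()))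
    (begin
      (x e₁ ⊕ x e₂) ⊕ x e₁₂               ≡⟨ cong (_⊕ x e₁₂) (π-linear (point e₁) (point e₂)) ⟨
      π (point e₁ ⊕ point e₂) ⊕ x e₁₂     ≡⟨ π-linear (point e₁ ⊕ point e₂) (point e₁₂) ⟨
      π ((point e₁ ⊕ point e₂) ⊕ point e₁₂) ≡⟨ cong (λ w → π (w ⊕ point e₁₂)) (comb-⊕ a b c e₁ e₂) ⟨
      π (point e₁₂ ⊕ point e₁₂)           ≡⟨ cong π (⊕-self (point e₁₂)) ⟩
      𝟘                                   ∎)
    where
    e₁₂ : V 3
    e₁₂ = true ∷ true ∷ false ∷ []
    x : V 3 → V _
    x u = π (point u)
    x∈N : ∀ u → pts MK4 u → pts N (x u)
    x∈N u pu with point u | point∈F Q C≡[] u pu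
    ... | β ∷ t | Fpoint = down β t (F⊆M _ Fpoint)
    x-injective : ∀ u v → u ≢ v → 𝟙 ⊕ u ≢ v → x u ≢ x v
    x-injective u v u≢v 𝟙⊕u≢v xu≡xv with fibre π-linear π-kernel xu≡xv
    ... | inj₁ pv≡pu    = u≢v (sym (point-injective v u pv≡pu))
    ... | inj₂ pv≡a⊕pu  = 𝟙⊕u≢v (sym (point-injective v (𝟙 ⊕ u)
                            (trans pv≡a⊕pu (trans (cong (_⊕ point u) (mod-[] Q C≡[] s)) (sym (comb-⊕ a b c 𝟙 u))))))

  apex≢𝟙 : ¬ (apex ≡ point 𝟙 [mod C ])
  apex≢𝟙 s with C in C≡
  ... | []    = empty-C-triangle C≡ (subst (λ K → apex ≡ point 𝟙 [mod K ]) (sym C≡) s)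
  ... | y ∷ _ = C-avoids-apex≡𝟙 (λ p → nonzero N 𝟘 p refl) (subst (λ K → apex ≡ point 𝟙 [mod K ]) (sym C≡) s)
                  (subst (y ∈_) (sym C≡) (here refl))

module _ {s r} {P : V s → Set} {ι : V s → V r}
  (span-ι  : ∀ {L x} → All P L → P x → Span L x → Span (map ι L) (ι x))
  (span-ι⁻ : ∀ {L x} → All P L → P x → Span (map ι L) (ι x) → Span L x) where

  private
    split-ι : ∀ L m → sumV (map ι L) ≡ sumV (map ι (select L m)) ⊕ sumV (map ι (reject L m))
    split-ι L m = trans (sumV-select-reject (map ι L) m)
                        (sym (cong₂ _⊕_ (cong sumV (map-select ι L m)) (cong sumV (map-reject ι L m))))

    All-sub : ∀ {L K} → (∀ {x} → x ∈ K → x ∈ L) → All P L → All P K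
    All-sub K⊆L a = All.tabulate (λ m → All.lookup a (K⊆L m))

    -- Writing x = Σ L' as the sum of a sublist S of L' leaves a complement R
    -- with Σ R = 0, and both x ∷ S and R are shorter than x ∷ L' unless R = [].
    transfer : ∀ n L → length L ≤ n → All P L → sumV L ≡ 𝟘 → sumV (map ι L) ≡ 𝟘
    reflect  : ∀ n L → length L ≤ n → All P L → sumV (map ι L) ≡ 𝟘 → sumV L ≡ 𝟘

    transfer n       []       _         _          _ = refl
    transfer (suc n) (x ∷ L') (s≤s len) (px ∷ pL') e
      with span-ι pL' px (subst (Span L') (sym (⊕≡𝟘⇒≡ e)) (span-sumV L'))
    ... | mask m ιS≡ιx = ≡⇒⊕≡𝟘 (sym (begin
      sumV (map ι L')                   ≡⟨ split-ι L' m ⟩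
      sumV (map ι S) ⊕ sumV (map ι R)   ≡⟨ cong₂ _⊕_ ΣιS≡ιx ΣιR≡𝟘 ⟩
      ι x ⊕ 𝟘                           ≡⟨ ⊕-identityʳ (ι x) ⟩
      ι x                               ∎))
      where
      S R : List (V s)
      S = select L' m
      R = reject L' m
      ΣιS≡ιx : sumV (map ι S) ≡ ι x
      ΣιS≡ιx = trans (cong sumV (map-select ι L' m)) (trans (sumV-select (map ι L') m) ιS≡ιx)
      ΣιR≡𝟘 : sumV (map ι R) ≡ 𝟘
      ΣιR≡𝟘 with select-all-or-shorter L' m
      ... | inj₁ R≡[] = cong (sumV ∘ map ι) R≡[]
      ... | inj₂ lt   = transfer n R (ℕₚ.≤-trans (length-reject L' m) len) (All-sub (reject-⊆ L' m) pL') (begin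
        sumV R                       ≡⟨ ⊕-cancelˡ (sumV S) (sumV R) ⟨
        sumV S ⊕ (sumV S ⊕ sumV R)   ≡⟨ cong₂ _⊕_ (sym x≡ΣS) (sym (sumV-select-reject L' m)) ⟩
        x ⊕ sumV L'                  ≡⟨ e ⟩
        𝟘                            ∎)
        where
        x≡ΣS : x ≡ sumV S
        x≡ΣS = ⊕≡𝟘⇒≡ (reflect n (x ∷ S) (ℕₚ.≤-trans lt len) (px ∷ All-sub (select-⊆ L' m) pL') (≡⇒⊕≡𝟘 (sym ΣιS≡ιx)))

    reflect n       []       _         _          _ = refl
    reflect (suc n) (x ∷ L') (s≤s len) (px ∷ pL') e
      with span-ι⁻ pL' px (subst (Span (map ι L')) (sym (⊕≡𝟘⇒≡ e)) (span-sumV (map ι L')))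
    ... | mask m S≡x = ≡⇒⊕≡𝟘 (sym (begin
      sumV L'           ≡⟨ sumV-select-reject L' m ⟩
      sumV S ⊕ sumV R   ≡⟨ cong₂ _⊕_ (trans (sumV-select L' m) S≡x) ΣR≡𝟘 ⟩
      x ⊕ 𝟘             ≡⟨ ⊕-identityʳ x ⟩
      x                 ∎))
      where
      S R : List (V s)
      S = select L' m
      R = reject L' m
      ΣR≡𝟘 : sumV R ≡ 𝟘
      ΣR≡𝟘 with select-all-or-shorter L' m
      ... | inj₁ R≡[] = cong sumV R≡[]
      ... | inj₂ lt   = reflect n R (ℕₚ.≤-trans (length-reject L' m) len) (All-sub (reject-⊆ L' m) pL') (begin
        sumV (map ι R)                                        ≡⟨ ⊕-cancelˡ (sumV (map ι S)) _ ⟨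
        sumV (map ι S) ⊕ (sumV (map ι S) ⊕ sumV (map ι R))   ≡⟨ cong₂ _⊕_ (sym ιx≡ΣιS) (sym (split-ι L' m)) ⟩
        ι x ⊕ sumV (map ι L')                                 ≡⟨ e ⟩
        𝟘                                                     ∎)
        where
        ιx≡ΣιS : ι x ≡ sumV (map ι S)
        ιx≡ΣιS = ⊕≡𝟘⇒≡ (transfer n (x ∷ S) (ℕₚ.≤-trans lt len) (px ∷ All-sub (select-⊆ L' m) pL')
                                  (≡⇒⊕≡𝟘 (sym (trans (sumV-select L' m) S≡x))))

  sumV≡𝟘-transfer : ∀ L → All P L → sumV L ≡ 𝟘 → sumV (map ι L) ≡ 𝟘
  sumV≡𝟘-transfer L = transfer _ L ℕₚ.≤-refl

  sumV≡𝟘-reflect : ∀ L → All P L → sumV (map ι L) ≡ 𝟘 → sumV L ≡ 𝟘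
  sumV≡𝟘-reflect L = reflect _ L ℕₚ.≤-refl

-- Generalized parallel connections

-- Consequences of IsGPC, stated symmetrically in M₁ and M₂ so that swap applies.
record ParallelConnection {r₁ r₂ r} (M₁ : BinMat r₁) (M₂ : BinMat r₂) (M : BinMat r) : Set₁ where
  field
    ι₁     : V r₁ → V r
    ι₂     : V r₂ → V r
    ι₁-pts : ∀ x → pts M₁ x → pts M (ι₁ x)
    ι₂-pts : ∀ y → pts M₂ y → pts M (ι₂ y)
    ι₁-inj : ∀ x x' → pts M₁ x → pts M₁ x' → ι₁ x ≡ ι₁ x' → x ≡ x'
    ι₂-inj : ∀ y y' → pts M₂ y → pts M₂ y' → ι₂ y ≡ ι₂ y' → y ≡ y'

  E₁ : Subset r
  E₁ = img ι₁ (pts M₁)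

  E₂ : Subset r
  E₂ = img ι₂ (pts M₂)

  field
    cover   : ∀ v → pts M v → E₁ v ⊎ E₂ v
    T       : Subset r
    T⊆E₁    : T ⊆ E₁
    T⊆E₂    : T ⊆ E₂
    E₁∩E₂⊆T : ∀ v → E₁ v → E₂ v → T v
    T-⊕     : ∀ v w → T v → T w → v ≢ w → T (v ⊕ w)
    ι₁-⊕    : ∀ x x' → pts M₁ x → pts M₁ x' → T (ι₁ x) → T (ι₁ x') → x ≢ x' →
              pts M₁ (x ⊕ x') × ι₁ (x ⊕ x') ≡ ι₁ x ⊕ ι₁ x'
    ι₂-⊕    : ∀ y y' → pts M₂ y → pts M₂ y' → T (ι₂ y) → T (ι₂ y') → y ≢ y' →
              pts M₂ (y ⊕ y') × ι₂ (y ⊕ y') ≡ ι₂ y ⊕ ι₂ y'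
    T-list          : List (V r)
    T-list⊆T        : All T T-list
    T-list-complete : ∀ v → T v → v ∈ T-list
    preimage₁-Flat      : ∀ X → Flat M X → Flat M₁ (preimage M₁ ι₁ X)
    preimage₂-Flat      : ∀ X → Flat M X → Flat M₂ (preimage M₂ ι₂ X)
    Flat-from-preimages : ∀ X → X ⊆ pts M → Flat M₁ (preimage M₁ ι₁ X) → Flat M₂ (preimage M₂ ι₂ X) → Flat M X

  T₀ : Subset r
  T₀ v = v ≡ 𝟘 ⊎ T v

  T₁ : Subset r₁
  T₁ = preimage M₁ ι₁ T

  T⊆M : T ⊆ pts M
  T⊆M v t with T⊆E₁ v t
  ... | x , px , refl = ι₁-pts x px

  T₀-⊕ : ∀ {v w} → T₀ v → T₀ w → T₀ (v ⊕ w)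
  T₀-⊕ {v} {w} (inj₁ refl) tw          = subst T₀ (sym (⊕-identityˡ w)) tw
  T₀-⊕ {v} {w} (inj₂ tv)   (inj₁ refl) = subst T₀ (sym (⊕-identityʳ v)) (inj₂ tv)
  T₀-⊕ {v} {w} (inj₂ tv)   (inj₂ tw) with v ≟V w
  ... | yes v≡w = inj₁ (≡⇒⊕≡𝟘 v≡w)
  ... | no  v≢w = inj₂ (T-⊕ v w tv tw v≢w)

  T₀-sumV : ∀ L → All T L → T₀ (sumV L)
  T₀-sumV []      []       = inj₁ refl
  T₀-sumV (x ∷ L) (t ∷ ts) = T₀-⊕ (inj₂ t) (T₀-sumV L ts)

swap : ∀ {r₁ r₂ r} {M₁ : BinMat r₁} {M₂ : BinMat r₂} {M : BinMat r} →
       ParallelConnection M₁ M₂ M → ParallelConnection M₂ M₁ M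
swap P = record
  { ι₁ = ι₂ ; ι₂ = ι₁ ; ι₁-pts = ι₂-pts ; ι₂-pts = ι₁-pts ; ι₁-inj = ι₂-inj ; ι₂-inj = ι₁-inj
  ; cover = λ v pv → Data.Sum.swap (cover v pv)
  ; T = T ; T⊆E₁ = T⊆E₂ ; T⊆E₂ = T⊆E₁ ; E₁∩E₂⊆T = λ v e₂ e₁ → E₁∩E₂⊆T v e₁ e₂ ; T-⊕ = T-⊕
  ; ι₁-⊕ = ι₂-⊕ ; ι₂-⊕ = ι₁-⊕ ; T-list = T-list ; T-list⊆T = T-list⊆T ; T-list-complete = T-list-complete
  ; preimage₁-Flat = preimage₂-Flat ; preimage₂-Flat = preimage₁-Flat
  ; Flat-from-preimages = λ X X⊆M fl₂ fl₁ → Flat-from-preimages X X⊆M fl₁ fl₂ }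
  where open ParallelConnection P

module _ {r₁ r₂ r} {M₁ : BinMat r₁} {M₂ : BinMat r₂} {M : BinMat r} (P : ParallelConnection M₁ M₂ M) where
  open ParallelConnection P

  span-ι₁ : ∀ {L x} → All (pts M₁) L → pts M₁ x → Span L x → Span (map ι₁ L) (ι₁ x)
  span-ι₁ = span-image {N = M₁} {M = M} ι₁-pts preimage₁-Flat

  ι₁-sumV-T : ∀ K → All T₁ K →
              (sumV K ≡ 𝟘 × sumV (map ι₁ K) ≡ 𝟘) ⊎ (T₁ (sumV K) × ι₁ (sumV K) ≡ sumV (map ι₁ K))
  ι₁-sumV-T []      []                = inj₁ (refl , refl)
  ι₁-sumV-T (k ∷ K) ((pk , tk) ∷ K⊆T₁) with ι₁-sumV-T K K⊆T₁
  ... | inj₁ (ΣK≡𝟘 , Σι₁K≡𝟘) =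
    inj₂ (subst T₁ (sym k⊕ΣK≡k) (pk , tk) , trans (cong ι₁ k⊕ΣK≡k) (sym (trans (cong (ι₁ k ⊕_) Σι₁K≡𝟘) (⊕-identityʳ _))))
    where
    k⊕ΣK≡k : k ⊕ sumV K ≡ k
    k⊕ΣK≡k = trans (cong (k ⊕_) ΣK≡𝟘) (⊕-identityʳ k)
  ... | inj₂ ((pΣ , tΣ) , ι₁Σ≡Σι₁) with k ≟V sumV K
  ...   | yes k≡ΣK = inj₁ (≡⇒⊕≡𝟘 k≡ΣK , trans (cong (ι₁ k ⊕_) (sym ι₁Σ≡Σι₁)) (≡⇒⊕≡𝟘 (cong ι₁ k≡ΣK)))
  ...   | no  k≢ΣK with ι₁-⊕ k (sumV K) pk pΣ tk tΣ k≢ΣK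
  ...     | p⊕ , ι₁⊕ = inj₂ ((p⊕ , subst T (sym ι₁⊕) (T-⊕ _ _ tk tΣ (k≢ΣK ∘ ι₁-inj _ _ pk pΣ))) ,
                             trans ι₁⊕ (cong (ι₁ k ⊕_) ι₁Σ≡Σι₁))

module _ {r₁ r₂ r} {M₁ : BinMat r₁} {M₂ : BinMat r₂} {M : BinMat r} (P : ParallelConnection M₁ M₂ M) where
  open ParallelConnection P

  T-from : Subset r₁ → Subset r₂
  T-from Z y = pts M₂ y × img ι₁ Z (ι₂ y)

  private
    lift-T-from : ∀ {Z} → Z ⊆ pts M₁ → ∀ K → All (T-from Z) K → Σ (List (V r₁)) λ K' →
                  All Z K' × All T₁ K' × All (ParallelConnection.T₁ (swap P)) K × map ι₁ K' ≡ map ι₂ K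
    lift-T-from Z⊆M₁ []      []                                = [] , [] , [] , [] , refl
    lift-T-from Z⊆M₁ (k ∷ K) ((pk , x' , Zx' , e) ∷ K⊆T-from) with lift-T-from Z⊆M₁ K K⊆T-from
    ... | K' , K'⊆Z , K'⊆T₁ , K⊆T₂ , eq =
      x' ∷ K' , Zx' ∷ K'⊆Z , (Z⊆M₁ x' Zx' , subst T (sym e) t) ∷ K'⊆T₁ , (pk , t) ∷ K⊆T₂ , cong₂ _∷_ e eq
      where
      t : T (ι₂ k)
      t = E₁∩E₂⊆T (ι₂ k) (x' , Z⊆M₁ x' Zx' , e) (k , pk , refl)

  -- T-from Z lies in T, where ι₁ and ι₂ are additive, so its span meets E₁
  -- only inside the span of Z.
  inSpan-T-from : ∀ {Z} → Flat M₁ Z → ∀ {x y} → pts M₁ x → pts M₂ y → InSpan (T-from Z) y → ι₂ y ≡ ι₁ x → Z x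
  inSpan-T-from {Z} Z-flat {x} px py (K , K⊆T-from , refl) ι₂y≡ι₁x with lift-T-from (proj₁ Z-flat) K K⊆T-from
  ... | K' , K'⊆Z , K'⊆T₁ , K⊆T₂ , ι₁K'≡ι₂K with ι₁-sumV-T (swap P) K K⊆T₂
  ...   | inj₁ (ΣK≡𝟘 , _) = ⊥-elim (nonzero M₂ _ py ΣK≡𝟘)
  ...   | inj₂ (_ , ι₂Σ≡Σι₂) with ι₁-sumV-T P K' K'⊆T₁
  ...     | inj₁ (_ , Σι₁K'≡𝟘) =
    ⊥-elim (nonzero M _ (ι₂-pts _ py) (trans ι₂Σ≡Σι₂ (trans (cong sumV (sym ι₁K'≡ι₂K)) Σι₁K'≡𝟘)))
  ...     | inj₂ ((pΣ , _) , ι₁Σ≡Σι₁) =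
    subst Z (ι₁-inj _ _ pΣ px ι₁ΣK'≡ι₁x) (proj₂ Z-flat _ pΣ (K' , K'⊆Z , refl))
    where
    ι₁ΣK'≡ι₁x : ι₁ (sumV K') ≡ ι₁ x
    ι₁ΣK'≡ι₁x = trans ι₁Σ≡Σι₁ (trans (cong sumV ι₁K'≡ι₂K) (trans (sym ι₂Σ≡Σι₂) ι₂y≡ι₁x))

  -- The closure Z of L in M₁ and the closure in M₂ of T-from Z glue to a
  -- flat of M; it contains ι₁ L, hence ι₁ x.
  span-ι₁⁻ : ∀ {L x} → All (pts M₁) L → pts M₁ x → Span (map ι₁ L) (ι₁ x) → Span L x
  span-ι₁⁻ {L} {x} L⊆M₁ px sp = proj₂ (X₁⊆Z x px (proj₂ X-flat (ι₁ x) (ι₁-pts x px) ι₁x∈⟨X⟩))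
    where
    Z : Subset r₁
    Z x = pts M₁ x × Span L x
    G : Subset r₂
    G y = pts M₂ y × InSpan (T-from Z) y
    X : Subset r
    X v = pts M v × (img ι₁ Z v ⊎ img ι₂ G v)

    X₁⊆Z : ∀ x → pts M₁ x → X (ι₁ x) → Z x
    X₁⊆Z x px (_ , inj₁ (x' , Zx' , e))        = subst Z (ι₁-inj _ _ (proj₁ Zx') px e) Zx'
    X₁⊆Z x px (_ , inj₂ (y , (py , y∈⟨T⟩) , e)) = inSpan-T-from (span-Flat M₁ L) px py y∈⟨T⟩ e

    X₁-flat : Flat M₁ (preimage M₁ ι₁ X)
    X₁-flat = Flat-≐ M₁ (span-Flat M₁ L) (λ v Zv → proj₁ Zv , ι₁-pts v (proj₁ Zv) , inj₁ (v , Zv , refl))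
                                         (λ v (pv , Xv) → X₁⊆Z v pv Xv)

    X₂-flat : Flat M₂ (preimage M₂ ι₂ X)
    X₂-flat = Flat-≐ M₂ (closure-Flat M₂ (T-from Z)) (λ v Gv → proj₁ Gv , ι₂-pts v (proj₁ Gv) , inj₂ (v , Gv , refl)) X₂⊆G
      where
      X₂⊆G : ∀ y → preimage M₂ ι₂ X y → G y
      X₂⊆G y (py , _ , inj₂ (y' , Gy' , e)) = subst G (ι₂-inj _ _ (proj₁ Gy') py e) Gy'
      X₂⊆G y (py , _ , inj₁ (x , Zx , e))   = py , inSpan-∈ (T-from Z) (py , x , Zx , e)

    X-flat : Flat M X
    X-flat = Flat-from-preimages X (λ v → proj₁) X₁-flat X₂-flat

    ι₁x∈⟨X⟩ : InSpan X (ι₁ x)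
    ι₁x∈⟨X⟩ = span⇒inSpan X (map ι₁ L) (Allₚ.map⁺ (All.tabulate λ {y} y∈L →
                let py = All.lookup L⊆M₁ y∈L in ι₁-pts y py , inj₁ (y , (py , span-∈ y∈L) , refl))) sp

  -- The flat E₁ ∪ ι₂(cl₂(T ∪ B')) of M contains b.
  span-T-list : ∀ As b B' → All E₁ As → E₂ b → All E₂ B' → sumV As ≡ b ⊕ sumV B' → Span (T-list ++ B') b
  span-T-list As b B' As⊆E₁ E₂b B'⊆E₂ e = from-Y b∈Y
    where
    lifted : Σ (List (V r₂)) λ K → All (pts M₂) K × map ι₂ K ≡ T-list ++ B'
    lifted = All-img⁻ (T-list ++ B') (Allₚ.++⁺ (All.map (λ {v} → T⊆E₂ v) T-list⊆T) B'⊆E₂)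
    K₂ : List (V r₂)
    K₂ = proj₁ lifted
    K₂⊆M₂ : All (pts M₂) K₂
    K₂⊆M₂ = proj₁ (proj₂ lifted)
    ι₂K₂≡K : map ι₂ K₂ ≡ T-list ++ B'
    ι₂K₂≡K = proj₂ (proj₂ lifted)

    G : Subset r₂
    G y = pts M₂ y × Span K₂ y
    Y : Subset r
    Y v = pts M v × (E₁ v ⊎ img ι₂ G v)

    ι₂-in-G : ∀ {y} → pts M₂ y → ι₂ y ∈ T-list ++ B' → G y
    ι₂-in-G {y} py ι₂y∈K with ∈-map⁻ ι₂ (subst (ι₂ y ∈_) (sym ι₂K₂≡K) ι₂y∈K)
    ... | k , k∈K₂ , ι₂y≡ι₂k = py , subst (Span K₂) (ι₂-inj _ _ (All.lookup K₂⊆M₂ k∈K₂) py (sym ι₂y≡ι₂k)) (span-∈ k∈K₂)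

    Y-flat : Flat M Y
    Y-flat = Flat-from-preimages Y (λ v → proj₁)
      (Flat-≐ M₁ (pts-Flat M₁) (λ x px → px , ι₁-pts x px , inj₁ (x , px , refl)) (λ x → proj₁))
      (Flat-≐ M₂ (span-Flat M₂ K₂) (λ y Gy → proj₁ Gy , ι₂-pts y (proj₁ Gy) , inj₂ (y , Gy , refl)) Y₂⊆G)
      where
      Y₂⊆G : ∀ y → preimage M₂ ι₂ Y y → G y
      Y₂⊆G y (py , _ , inj₂ (y' , Gy' , e)) = subst G (ι₂-inj _ _ (proj₁ Gy') py e) Gy'
      Y₂⊆G y (py , _ , inj₁ E₁y) = ι₂-in-G py (∈-++⁺ˡ (T-list-complete _ (E₁∩E₂⊆T _ E₁y (y , py , refl))))

    As⊆Y : All Y As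
    As⊆Y = All.map (λ { (x , px , refl) → ι₁-pts x px , inj₁ (x , px , refl) }) As⊆E₁

    B'⊆Y : All Y B'
    B'⊆Y = All.tabulate λ v∈B' → B'-point v∈B' (All.lookup B'⊆E₂ v∈B')
      where
      B'-point : ∀ {v} → v ∈ B' → E₂ v → Y v
      B'-point v∈B' (y , py , refl) = ι₂-pts y py , inj₂ (y , ι₂-in-G py (∈-++⁺ʳ T-list v∈B') , refl)

    b∈Y : Y b
    b∈Y = proj₂ Y-flat b (E₂⊆M E₂b) (subst (InSpan Y) b≡
            (inSpan-⊕ Y (span⇒inSpan Y As As⊆Y (span-sumV As)) (span⇒inSpan Y B' B'⊆Y (span-sumV B'))))
      where
      E₂⊆M : ∀ {v} → E₂ v → pts M v
      E₂⊆M (y , py , refl) = ι₂-pts y py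
      b≡ : sumV As ⊕ sumV B' ≡ b
      b≡ = trans (cong (_⊕ sumV B') e) (⊕-cancelʳ (sumV B') b)

    from-Y : Y b → Span (T-list ++ B') b
    from-Y (_ , inj₁ E₁b) = span-∈ (∈-++⁺ˡ (T-list-complete b (E₁∩E₂⊆T b E₁b E₂b)))
    from-Y (_ , inj₂ (y , (py , y∈⟨K₂⟩) , ι₂y≡b)) =
      subst₂ Span ι₂K₂≡K ι₂y≡b (span-ι₁ (swap P) K₂⊆M₂ py y∈⟨K₂⟩)

  -- Induction on Bs: splitting b ∈ ⟨T-list ++ B'⟩ moves its T-part to the left
  -- and leaves a sublist of B' on the right.
  modular : ∀ As Bs → All E₁ As → All E₂ Bs → sumV As ≡ sumV Bs → T₀ (sumV As)
  modular As Bs = by-length (length Bs) As Bs ℕₚ.≤-refl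
    where
    by-length : ∀ n As Bs → length Bs ≤ n → All E₁ As → All E₂ Bs → sumV As ≡ sumV Bs → T₀ (sumV As)
    by-length n       As []       _         _     _              e = inj₁ e
    by-length (suc n) As (b ∷ B') (s≤s len) As⊆E₁ (E₂b ∷ B'⊆E₂) e
      with span-++⁻ T-list B' (span-T-list As b B' As⊆E₁ E₂b B'⊆E₂ e)
    ... | t , β , mask m refl , β∈⟨B'⟩ , t⊕β≡b with span-⊕ B' β∈⟨B'⟩ (span-sumV B')
    ...   | mask m' ΣB''≡ = subst T₀ (⊕-cancelʳ t (sumV As)) (T₀-⊕ IH (subst T₀ (sumV-select T-list m) (T₀-sumV Ts Ts⊆T)))
      where
      Ts : List (V r)
      Ts = select T-list m
      Ts⊆T : All T Ts
      Ts⊆T = All.tabulate λ p → All.lookup T-list⊆T (select-⊆ T-list m p)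
      B'' : List (V r)
      B'' = select B' m'
      t≡ΣTs : t ≡ sumV Ts
      t≡ΣTs = sym (sumV-select T-list m)
      sums : sumV (As ++ Ts) ≡ sumV B''
      sums = begin
        sumV (As ++ Ts)                ≡⟨ sumV-++ As Ts ⟩
        sumV As ⊕ sumV Ts              ≡⟨ cong₂ _⊕_ e (sym t≡ΣTs) ⟩
        (b ⊕ sumV B') ⊕ t              ≡⟨ cong (λ w → (w ⊕ sumV B') ⊕ t) (sym t⊕β≡b) ⟩
        ((t ⊕ β) ⊕ sumV B') ⊕ t        ≡⟨ solve 3 (λ t β σ → ((t ⊞ β) ⊞ σ) ⊞ t ⊜ β ⊞ σ) refl t β (sumV B') ⟩
        β ⊕ sumV B'                    ≡⟨ trans (sumV-select B' m') ΣB''≡ ⟨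
        sumV B''                       ∎
      IH : T₀ (sumV As ⊕ t)
      IH = subst T₀ (trans (sumV-++ As Ts) (cong (sumV As ⊕_) (sym t≡ΣTs)))
             (by-length n (As ++ Ts) B'' (ℕₚ.≤-trans (length-select B' m') len)
                (Allₚ.++⁺ As⊆E₁ (All.map (λ {v} → T⊆E₁ v) Ts⊆T))
                (All.tabulate λ p → All.lookup B'⊆E₂ (select-⊆ B' m' p)) sums)

  span-sumV-ι₁ : ∀ {K L} → All (pts M₁) K → All (pts M₁) L → Span L (sumV K) ⇔ Span (map ι₁ L) (sumV (map ι₁ K))
  span-sumV-ι₁ {K} {L} K⊆M₁ L⊆M₁ = mk⇔ forward backward
    where
    KS⊆M₁ : ∀ m → All (pts M₁) (K ++ select L m)
    KS⊆M₁ m = Allₚ.++⁺ K⊆M₁ (All.tabulate λ p → All.lookup L⊆M₁ (select-⊆ L m p))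
    ΣKS : ∀ m → sumV (K ++ select L m) ≡ sumV K ⊕ maskSum L m
    ΣKS m = trans (sumV-++ K _) (cong (sumV K ⊕_) (sumV-select L m))
    Σι₁KS : ∀ m → sumV (map ι₁ (K ++ select L m)) ≡ sumV (map ι₁ K) ⊕ maskSum (map ι₁ L) m
    Σι₁KS m = begin
      sumV (map ι₁ (K ++ select L m))                  ≡⟨ cong sumV (Listₚ.map-++ ι₁ K (select L m)) ⟩
      sumV (map ι₁ K ++ map ι₁ (select L m))           ≡⟨ sumV-++ (map ι₁ K) _ ⟩
      sumV (map ι₁ K) ⊕ sumV (map ι₁ (select L m))     ≡⟨ cong (λ S → sumV (map ι₁ K) ⊕ sumV S) (map-select ι₁ L m) ⟩
      sumV (map ι₁ K) ⊕ sumV (select (map ι₁ L) m)     ≡⟨ cong (sumV (map ι₁ K) ⊕_) (sumV-select (map ι₁ L) m) ⟩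
      sumV (map ι₁ K) ⊕ maskSum (map ι₁ L) m           ∎
    forward : Span L (sumV K) → Span (map ι₁ L) (sumV (map ι₁ K))
    forward (mask m e) = mask m (sym (⊕≡𝟘⇒≡ (trans (sym (Σι₁KS m))
      (sumV≡𝟘-transfer (span-ι₁ P) span-ι₁⁻ _ (KS⊆M₁ m) (trans (ΣKS m) (≡⇒⊕≡𝟘 (sym e)))))))
    backward : Span (map ι₁ L) (sumV (map ι₁ K)) → Span L (sumV K)
    backward (mask m e) = mask m (sym (⊕≡𝟘⇒≡ (trans (sym (ΣKS m))
      (sumV≡𝟘-reflect (span-ι₁ P) span-ι₁⁻ _ (KS⊆M₁ m) (trans (Σι₁KS m) (≡⇒⊕≡𝟘 (sym e)))))))

module _ {r₁ r₂ r} {M₁ : BinMat r₁} {M₂ : BinMat r₂} {M : BinMat r}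
         (P : ParallelConnection M₁ M₂ M) (Q : K4Certificate M) where
  open ParallelConnection P
  open K4Certificate Q

  private
    E₁-part : ∀ L → All (pts M) L → List (V r)
    E₁-part []      []        = []
    E₁-part (x ∷ L) (px ∷ pL) with cover x px
    ... | inj₁ _ = x ∷ E₁-part L pL
    ... | inj₂ _ = E₁-part L pL

    E₁-part-sound : ∀ L pL → All (λ x → x ∈ L × E₁ x) (E₁-part L pL)
    E₁-part-sound []      []        = []
    E₁-part-sound (x ∷ L) (px ∷ pL) with cover x px
    ... | inj₁ E₁x = (here refl , E₁x) ∷ All.map (λ (x∈L , E₁x) → there x∈L , E₁x) (E₁-part-sound L pL)
    ... | inj₂ _   = All.map (λ (x∈L , E₁x) → there x∈L , E₁x) (E₁-part-sound L pL)

    E₁-part-complete : ∀ L pL {y} → y ∈ L → y ∈ E₁-part L pL ⊎ E₂ y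
    E₁-part-complete (x ∷ L) (px ∷ pL) y∈ with cover x px | y∈
    ... | inj₁ _   | here refl = inj₁ (here refl)
    ... | inj₂ E₂x | here refl = inj₂ E₂x
    ... | inj₁ _   | there p   = Data.Sum.map₁ there (E₁-part-complete L pL p)
    ... | inj₂ _   | there p   = E₁-part-complete L pL p

    C⊆M : All (pts M) C
    C⊆M = All.map (λ {v} → F⊆M v) C⊆F

  C₁ : List (V r)
  C₁ = E₁-part C C⊆M

  C₁⊆C : ∀ {x} → x ∈ C₁ → x ∈ C
  C₁⊆C p = proj₁ (All.lookup (E₁-part-sound C C⊆M) p)

  C₁⊆E₁ : All E₁ C₁
  C₁⊆E₁ = All.map proj₂ (E₁-part-sound C C⊆M)

  record Split (v : V r) : Set where
    field
      As Bs : List (V r)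
      As⊆C₁ : All (_∈ C₁) As
      Bs⊆C  : All (_∈ C) Bs
      Bs⊆E₂ : All E₂ Bs
      sums  : sumV As ⊕ sumV Bs ≡ v

  split : ∀ {v} → Span C v → Split v
  split = span-ind C Split (record { As = [] ; Bs = [] ; As⊆C₁ = [] ; Bs⊆C = [] ; Bs⊆E₂ = [] ; sums = ⊕-self 𝟘 })
    (λ s s' → record
      { As = Split.As s ++ Split.As s' ; Bs = Split.Bs s ++ Split.Bs s'
      ; As⊆C₁ = Allₚ.++⁺ (Split.As⊆C₁ s) (Split.As⊆C₁ s') ; Bs⊆C = Allₚ.++⁺ (Split.Bs⊆C s) (Split.Bs⊆C s')
      ; Bs⊆E₂ = Allₚ.++⁺ (Split.Bs⊆E₂ s) (Split.Bs⊆E₂ s')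
      ; sums = trans (cong₂ _⊕_ (sumV-++ (Split.As s) _) (sumV-++ (Split.Bs s) _))
                     (trans (⊕-interchange _ _ _ _) (cong₂ _⊕_ (Split.sums s) (Split.sums s'))) })
    member
    where
    member : ∀ {x} → x ∈ C → Split x
    member {x} x∈C with E₁-part-complete C C⊆M x∈C
    ... | inj₁ x∈C₁ = record { As = x ∷ [] ; Bs = [] ; As⊆C₁ = x∈C₁ ∷ [] ; Bs⊆C = [] ; Bs⊆E₂ = []
                             ; sums = solve 1 (λ x → (x ⊞ id) ⊞ id ⊜ x) refl x }
    ... | inj₂ E₂x  = record { As = [] ; Bs = x ∷ [] ; As⊆C₁ = [] ; Bs⊆C = x∈C ∷ [] ; Bs⊆E₂ = E₂x ∷ []
                             ; sums = solve 1 (λ x → id ⊞ (x ⊞ id) ⊜ x) refl x }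

  realised-somewhere : ∀ u → pts MK4 u → RealisedIn E₁ u ⊎ RealisedIn E₂ u
  realised-somewhere u pu with realised u pu
  ... | d , Fd , s = Data.Sum.map (λ E₁d → d , Fd , E₁d , s) (λ E₂d → d , Fd , E₂d , s) (cover d (F⊆M d Fd))

  -- The E₁-side of a relation d₁ ⊕ d₂ ≡ d mod ⟨C⟩ is a point of T by modularity.
  realisedIn-E₁-⊕ : ∀ {v w} → RealisedIn E₁ v → RealisedIn E₁ w → RealisedIn E₂ (v ⊕ w) → v ⊕ w ≢ 𝟘 →
                    RealisedIn E₁ (v ⊕ w)
  realisedIn-E₁-⊕ {v} {w} (d₁ , Fd₁ , E₁d₁ , s₁) (d₂ , Fd₂ , E₁d₂ , s₂) (d , Fd , E₂d , s) v⊕w≢𝟘 =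
    resolve (split (mod-trans d₁⊕d₂≡point (mod-sym s)))
    where
    d₁⊕d₂≡point : d₁ ⊕ d₂ ≡ point (v ⊕ w) [mod C ]
    d₁⊕d₂≡point = subst (λ p → d₁ ⊕ d₂ ≡ p [mod C ]) (sym (comb-⊕ a b c v w)) (mod-⊕ s₁ s₂)

    resolve : Split ((d₁ ⊕ d₂) ⊕ d) → RealisedIn E₁ (v ⊕ w)
    resolve σ = [ (λ z≡𝟘 → ⊥-elim (v⊕w≢𝟘 (independent (v ⊕ w) (point∈⟨C⟩ z≡𝟘)))) , z-realises ]′
                  (modular P (d₁ ∷ d₂ ∷ As) (d ∷ Bs) (E₁d₁ ∷ E₁d₂ ∷ All.map (All.lookup C₁⊆E₁) As⊆C₁) (E₂d ∷ Bs⊆E₂) balance)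
      where
      open Split σ
      z : V r
      z = d₁ ⊕ (d₂ ⊕ sumV As)
      ΣAs∈⟨C⟩ : Span C (sumV As)
      ΣAs∈⟨C⟩ = span-sumV-⊆ (All.map C₁⊆C As⊆C₁)
      balance : z ≡ d ⊕ sumV Bs
      balance = ⊕≡𝟘⇒≡ (trans (solve 5 (λ a b x c y → (a ⊞ (b ⊞ x)) ⊞ (c ⊞ y) ⊜ (x ⊞ y) ⊞ ((a ⊞ b) ⊞ c)) refl
                                        d₁ d₂ (sumV As) d (sumV Bs))
                             (≡⇒⊕≡𝟘 sums))
      point∈⟨C⟩ : z ≡ 𝟘 → Span C (point (v ⊕ w))
      point∈⟨C⟩ z≡𝟘 = subst (Span C) (⊕-identityʳ _) (mod-trans (mod-sym s) (mod-𝟘 d∈⟨C⟩))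
        where
        d∈⟨C⟩ : Span C d
        d∈⟨C⟩ = subst (Span C) (sym (⊕≡𝟘⇒≡ (trans (sym balance) z≡𝟘))) (span-sumV-⊆ Bs⊆C)
      z-realises : T z → RealisedIn E₁ (v ⊕ w)
      z-realises Tz = z , Fz , T⊆E₁ z Tz , z≡point
        where
        Fz : F z
        Fz = proj₂ F-flat z (T⊆M z Tz)
               (inSpan-⊕ F (inSpan-∈ F Fd₁) (inSpan-⊕ F (inSpan-∈ F Fd₂) (span⇒inSpan F C C⊆F ΣAs∈⟨C⟩)))
        z≡point : z ≡ point (v ⊕ w) [mod C ]
        z≡point = subst₂ (λ x y → x ≡ y [mod C ]) (⊕-assoc d₁ d₂ (sumV As)) (⊕-identityʳ _)
                         (mod-⊕ d₁⊕d₂≡point (mod-𝟘 ΣAs∈⟨C⟩))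

  realisedIn-E₁-closed : TriangleClosed (RealisedIn E₁)
  realisedIn-E₁-closed {v} {w} rv rw pvw with realised-somewhere (v ⊕ w) pvw
  ... | inj₁ r₁ = r₁
  ... | inj₂ r₂ = realisedIn-E₁-⊕ rv rw r₂ (proj₁ pvw)

  private
    T-in-C : List (V r)
    T-in-C = filter (span? C) T-list

    -- The points of T in ⟨C⟩ carry the part of ⟨C⟩ that passes through E₂.
    Ĉ : List (V r)
    Ĉ = C₁ ++ T-in-C

    Ĉ⊆⟨C⟩ : ∀ {x} → x ∈ Ĉ → Span C x
    Ĉ⊆⟨C⟩ p with ∈-++⁻ C₁ p
    ... | inj₁ p₁ = span-∈ (C₁⊆C p₁)
    ... | inj₂ p₂ = proj₂ (∈-filter⁻ (span? C) {xs = T-list} p₂)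

    Ĉ⊆E₁ : All E₁ Ĉ
    Ĉ⊆E₁ = Allₚ.++⁺ C₁⊆E₁ (All.tabulate λ p → T⊆E₁ _ (All.lookup T-list⊆T (proj₁ (∈-filter⁻ (span? C) {xs = T-list} p))))

    Ĉ⊆F : All F Ĉ
    Ĉ⊆F = All.tabulate λ {x} p → proj₂ F-flat x (point-of p) (span⇒inSpan F C C⊆F (Ĉ⊆⟨C⟩ p))
      where
      point-of : ∀ {x} → x ∈ Ĉ → pts M x
      point-of {x} p with All.lookup Ĉ⊆E₁ p
      ... | y , py , refl = ι₁-pts y py

    -- Split the relation over C; its E₂-part is a point of T by modularity.
    E₁-sum-in-Ĉ : ∀ As → All E₁ As → Span C (sumV As) → Span Ĉ (sumV As)
    E₁-sum-in-Ĉ As As⊆E₁ sp = [ zero-case , T-case ]′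
      (modular P (As ++ As') Bs (Allₚ.++⁺ As⊆E₁ (All.map (All.lookup C₁⊆E₁) As'⊆C₁)) Bs⊆E₂ balance)
      where
      open Split (split sp) renaming (As to As'; As⊆C₁ to As'⊆C₁)
      balance : sumV (As ++ As') ≡ sumV Bs
      balance = ⊕≡𝟘⇒≡ (trans (cong (_⊕ sumV Bs) (sumV-++ As As'))
                  (trans (solve 3 (λ x a b → (x ⊞ a) ⊞ b ⊜ x ⊞ (a ⊞ b)) refl (sumV As) (sumV As') (sumV Bs))
                    (trans (cong (sumV As ⊕_) sums) (⊕-self (sumV As)))))
      ΣAs'∈⟨Ĉ⟩ : Span Ĉ (sumV As')
      ΣAs'∈⟨Ĉ⟩ = span-sumV-⊆ (All.map (∈-++⁺ˡ) As'⊆C₁)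
      zero-case : sumV (As ++ As') ≡ 𝟘 → Span Ĉ (sumV As)
      zero-case z≡𝟘 = subst (Span Ĉ) ΣAs'≡ΣAs ΣAs'∈⟨Ĉ⟩
        where
        ΣAs'≡ΣAs : sumV As' ≡ sumV As
        ΣAs'≡ΣAs = trans (sym (⊕-identityʳ _)) (trans (cong (sumV As' ⊕_) (sym (trans (sym balance) z≡𝟘))) sums)
      T-case : T (sumV (As ++ As')) → Span Ĉ (sumV As)
      T-case Tz = subst (Span Ĉ) sums (span-⊕ Ĉ ΣAs'∈⟨Ĉ⟩ (span-∈ (∈-++⁺ʳ C₁ ΣBs∈T-in-C)))
        where
        ΣBs∈T-in-C : sumV Bs ∈ T-in-C
        ΣBs∈T-in-C = ∈-filter⁺ (span? C) (T-list-complete _ (subst T balance Tz)) (span-sumV-⊆ Bs⊆C)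

  module ToM₁ (realised-in-E₁ : ∀ u → pts MK4 u → RealisedIn E₁ u) where

    private
      lifted : Σ (List (V r₁)) λ K → All (pts M₁) K × map ι₁ K ≡ Ĉ
      lifted = All-img⁻ Ĉ Ĉ⊆E₁
      Ĉ₁ : List (V r₁)
      Ĉ₁ = proj₁ lifted
      Ĉ₁⊆M₁ : All (pts M₁) Ĉ₁
      Ĉ₁⊆M₁ = proj₁ (proj₂ lifted)
      ι₁Ĉ₁≡Ĉ : map ι₁ Ĉ₁ ≡ Ĉ
      ι₁Ĉ₁≡Ĉ = proj₂ (proj₂ lifted)

      Ĉ₁⊆F₁ : All (preimage M₁ ι₁ F) Ĉ₁
      Ĉ₁⊆F₁ = All.zip (Ĉ₁⊆M₁ , Allₚ.map⁻ (subst (All F) (sym ι₁Ĉ₁≡Ĉ) Ĉ⊆F))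

      preimage-of : ∀ u → pts MK4 u → Σ (V r₁) λ x → pts M₁ x × ι₁ x ≡ point u [mod C ]
      preimage-of u pu with realised-in-E₁ u pu
      ... | _ , _ , (x , px , refl) , s = x , px , s

      a₁ b₁ c₁ : V r₁
      a₁ = proj₁ (preimage-of e₁ ◇)
      b₁ = proj₁ (preimage-of e₂ ◇)
      c₁ = proj₁ (preimage-of e₃ ◇)
      B : List (V r₁)
      B = a₁ ∷ b₁ ∷ c₁ ∷ []
      B⊆M₁ : All (pts M₁) B
      B⊆M₁ = proj₁ (proj₂ (preimage-of e₁ ◇)) ∷ proj₁ (proj₂ (preimage-of e₂ ◇)) ∷ proj₁ (proj₂ (preimage-of e₃ ◇)) ∷ []

      ι₁-point : ∀ u → comb (ι₁ a₁) (ι₁ b₁) (ι₁ c₁) u ≡ point u [mod C ]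
      ι₁-point = comb-mod (subst (λ p → ι₁ a₁ ≡ p [mod C ]) (comb-e₁ a b c) (proj₂ (proj₂ (preimage-of e₁ ◇))))
                          (subst (λ p → ι₁ b₁ ≡ p [mod C ]) (comb-e₂ a b c) (proj₂ (proj₂ (preimage-of e₂ ◇))))
                          (subst (λ p → ι₁ c₁ ≡ p [mod C ]) (comb-e₃ a b c) (proj₂ (proj₂ (preimage-of e₃ ◇))))

      terms : V 3 → List (V r₁)
      terms u = select B (coefficients u)
      terms⊆M₁ : ∀ u → All (pts M₁) (terms u)
      terms⊆M₁ u = All.tabulate λ p → All.lookup B⊆M₁ (select-⊆ B (coefficients u) p)
      Σterms : ∀ u → sumV (terms u) ≡ comb a₁ b₁ c₁ u
      Σterms u = trans (sumV-select B (coefficients u)) (sym (comb-maskSum a₁ b₁ c₁ u))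
      Σι₁terms : ∀ u → sumV (map ι₁ (terms u)) ≡ comb (ι₁ a₁) (ι₁ b₁) (ι₁ c₁) u
      Σι₁terms u = trans (cong sumV (map-select ι₁ B (coefficients u)))
                         (trans (sumV-select (map ι₁ B) (coefficients u)) (sym (comb-maskSum (ι₁ a₁) (ι₁ b₁) (ι₁ c₁) u)))

      to-Ĉ : ∀ {v} → Span (map ι₁ Ĉ₁) v → Span Ĉ v
      to-Ĉ {v} = subst (λ L → Span L v) ι₁Ĉ₁≡Ĉ

      transfer-relation : ∀ {x} u → pts M₁ x → ι₁ x ≡ point u [mod C ] → x ≡ comb a₁ b₁ c₁ u [mod Ĉ₁ ]
      transfer-relation {x} u px s =
        subst (Span Ĉ₁) (cong (x ⊕_) (Σterms u))
          (from (span-sumV-ι₁ P (px ∷ terms⊆M₁ u) Ĉ₁⊆M₁)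
                (subst (λ L → Span L (ι₁ x ⊕ sumV (map ι₁ (terms u)))) (sym ι₁Ĉ₁≡Ĉ) in-Ĉ))
        where
        in-Ĉ : Span Ĉ (ι₁ x ⊕ sumV (map ι₁ (terms u)))
        in-Ĉ = E₁-sum-in-Ĉ (map ι₁ (x ∷ terms u)) (Allₚ.map⁺ (All.map (λ {y} py → y , py , refl) (px ∷ terms⊆M₁ u)))
                 (subst (λ p → ι₁ x ≡ p [mod C ]) (sym (Σι₁terms u)) (mod-trans s (mod-sym (ι₁-point u))))

      independent₁ : ∀ u → Span Ĉ₁ (comb a₁ b₁ c₁ u) → u ≡ 𝟘
      independent₁ u sp = independent u (span-subtract C (span-mono Ĉ⊆⟨C⟩ (to-Ĉ ι₁-terms∈)) (ι₁-point u))
        where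
        ι₁-terms∈ : Span (map ι₁ Ĉ₁) (comb (ι₁ a₁) (ι₁ b₁) (ι₁ c₁) u)
        ι₁-terms∈ = subst (Span (map ι₁ Ĉ₁)) (Σι₁terms u)
                      (to (span-sumV-ι₁ P (terms⊆M₁ u) Ĉ₁⊆M₁) (subst (Span Ĉ₁) (sym (Σterms u)) sp))

      covered₁ : ∀ y → preimage M₁ ι₁ F y → Σ (V 3) λ u → u ≢ 𝟙 × y ≡ comb a₁ b₁ c₁ u [mod Ĉ₁ ]
      covered₁ y (py , Fι₁y) with covered (ι₁ y) Fι₁y
      ... | u , u≢𝟙 , s = u , u≢𝟙 , transfer-relation u py s

      realised₁ : ∀ u → pts MK4 u → Σ (V r₁) λ d → preimage M₁ ι₁ F d × d ≡ comb a₁ b₁ c₁ u [mod Ĉ₁ ]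
      realised₁ u pu with realised-in-E₁ u pu
      ... | _ , Fd , (x , px , refl) , s = x , (px , Fd) , transfer-relation u px s

    certificate : K4Certificate M₁
    certificate = record
      { F = preimage M₁ ι₁ F ; F-flat = preimage₁-Flat F F-flat ; C = Ĉ₁ ; C⊆F = Ĉ₁⊆F₁
      ; a = a₁ ; b = b₁ ; c = c₁
      ; independent = independent₁ ; covered = covered₁ ; realised = realised₁ }

parallel-connection-certificate : ∀ {r₁ r₂ r} {M₁ : BinMat r₁} {M₂ : BinMat r₂} {M : BinMat r} →
  ParallelConnection M₁ M₂ M → K4Certificate M → K4Certificate M₁ ⊎ K4Certificate M₂
parallel-connection-certificate P Q =
  Data.Sum.map (ToM₁.certificate P Q) (ToM₁.certificate (swap P) Q)
    (K4-monochromatic _ _ (realisedIn-E₁-closed P Q) (realisedIn-E₁-closed (swap P) Q) (realised-somewhere P Q))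

module _ {r₁ r₂ r} {M₁ : BinMat r₁} {M₂ : BinMat r₂} {M : BinMat r} (G : IsGPC M₁ M₂ M) where
  open IsGPC G

  private
    preimage₁-Flat : ∀ X → Flat M X → Flat M₁ (preimage M₁ ι₁ X)
    preimage₁-Flat X fl = proj₁ (to (flats X (proj₁ fl)) fl)

    preimage₂-Flat : ∀ X → Flat M X → Flat M₂ (preimage M₂ ι₂ X)
    preimage₂-Flat X fl = proj₂ (to (flats X (proj₁ fl)) fl)

    T₁ : Subset r₁
    T₁ = preimage M₁ ι₁ T

    k : ℕ
    k = proj₁ projGeom
    I : Iso (PG k) (restrict M₁ (preimage M₁ ι₁ T) (λ x → proj₁))
    I = proj₂ projGeom
    module I = Iso I

    -- T₁ ∪ {0} is a subspace, since M₁|T₁ is a projective geometry.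
    T₁-⊕ : ∀ {x x'} → T₁ x → T₁ x' → x ≢ x' → T₁ (x ⊕ x')
    T₁-⊕ {x} {x'} tx tx' x≢x' = subst T₁ f[u⊕u']≡x⊕x' (I.f-pts (u ⊕ u') u⊕u'≢𝟘)
      where
      u u' : V k
      u = I.g x
      u' = I.g x'
      u≢u' : u ≢ u'
      u≢u' e = x≢x' (trans (sym (I.fg x tx)) (trans (cong I.f e) (I.fg x' tx')))
      u⊕u'≢𝟘 : u ⊕ u' ≢ 𝟘
      u⊕u'≢𝟘 = u≢u' ∘ ⊕≡𝟘⇒≡
      f[u⊕u']≡x⊕x' : I.f (u ⊕ u') ≡ x ⊕ x'
      f[u⊕u']≡x⊕x' = trans (iso-additive I (I.g-pts x tx) (I.g-pts x' tx') u⊕u'≢𝟘 u≢u') (cong₂ _⊕_ (I.fg x tx) (I.fg x' tx'))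

    -- ι₁ (x ⊕ x') is in the span of ι₁ x and ι₁ x', and is none of 𝟘, ι₁ x, ι₁ x'.
    ι₁-⊕ : ∀ x x' → pts M₁ x → pts M₁ x' → T (ι₁ x) → T (ι₁ x') → x ≢ x' →
           pts M₁ (x ⊕ x') × ι₁ (x ⊕ x') ≡ ι₁ x ⊕ ι₁ x'
    ι₁-⊕ x x' px px' tx tx' x≢x' = px⊕x' , pair-case (span-pair (span-image {N = M₁} {M = M} ι₁-pts preimage₁-Flat
      (px ∷ px' ∷ []) px⊕x' (span-⊕ (x ∷ x' ∷ []) (span-∈ (here refl)) (span-∈ (there (here refl))))))
      where
      px⊕x' : pts M₁ (x ⊕ x')
      px⊕x' = proj₁ (T₁-⊕ (px , tx) (px' , tx') x≢x')
      pair-case : ι₁ (x ⊕ x') ≡ 𝟘 ⊎ ι₁ (x ⊕ x') ≡ ι₁ x ⊎ ι₁ (x ⊕ x') ≡ ι₁ x' ⊎ ι₁ (x ⊕ x') ≡ ι₁ x ⊕ ι₁ x' →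
                  ι₁ (x ⊕ x') ≡ ι₁ x ⊕ ι₁ x'
      pair-case (inj₁ z)               = ⊥-elim (nonzero M _ (ι₁-pts _ px⊕x') z)
      pair-case (inj₂ (inj₁ e))        = ⊥-elim (nonzero M₁ x' px' (⊕≡ˡ⇒≡𝟘 (ι₁-inj _ _ px⊕x' px e)))
      pair-case (inj₂ (inj₂ (inj₁ e))) = ⊥-elim (nonzero M₁ x px (⊕≡ʳ⇒≡𝟘 (ι₁-inj _ _ px⊕x' px' e)))
      pair-case (inj₂ (inj₂ (inj₂ e))) = e

    T-⊕ : ∀ v w → T v → T w → v ≢ w → T (v ⊕ w)
    T-⊕ _ _ tv@((x , px , refl) , _) tw@((x' , px' , refl) , _) v≢w =
      subst T (proj₂ (ι₁-⊕ x x' px px' tv tw x≢x')) (proj₂ (T₁-⊕ (px , tv) (px' , tw) x≢x'))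
      where
      x≢x' : x ≢ x'
      x≢x' = v≢w ∘ cong ι₁

    -- M₁|T₁ and M₂|T₂ have the same independent sets, hence the same triangles.
    T-triangle : ∀ {x x' x'' y y' y''} → T₁ x → T₁ x' → T₁ x'' → x ≢ x' → x ≢ x'' → x' ≢ x'' →
                 (x ⊕ x') ⊕ x'' ≡ 𝟘 → pts M₂ y → pts M₂ y' → pts M₂ y'' →
                 ι₁ x ≡ ι₂ y → ι₁ x' ≡ ι₂ y' → ι₁ x'' ≡ ι₂ y'' → (y ⊕ y') ⊕ y'' ≡ 𝟘
    T-triangle {x} {x'} {x''} {y} {y'} {y''} (px , tx) (px' , tx') (px'' , tx'') x≢x' x≢x'' x'≢x'' triangle
               py py' py'' ι₁x≡ ι₁x'≡ ι₁x''≡ =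
      dependent⇒triangle (nonzero M₂ y py) (nonzero M₂ y' py') (nonzero M₂ y'' py'')
        (ι₂-≢ px px' ι₁x≡ ι₁x'≡ x≢x') (ι₂-≢ px px'' ι₁x≡ ι₁x''≡ x≢x'') (ι₂-≢ px' px'' ι₁x'≡ ι₁x''≡ x'≢x'')
        (λ indep → M₁-dependent (from (sameRestr X X⊆T) (LinIndep-⊆ X₂⊆ indep)))
      where
      ι₂-≢ : ∀ {z z' w w'} → pts M₁ z → pts M₁ z' → ι₁ z ≡ ι₂ w → ι₁ z' ≡ ι₂ w' → z ≢ z' → w ≢ w'
      ι₂-≢ pz pz' e e' z≢z' refl = z≢z' (ι₁-inj _ _ pz pz' (trans e (sym e')))
      X : Subset r
      X v = v ∈ ι₁ x ∷ ι₁ x' ∷ ι₁ x'' ∷ []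
      X⊆T : X ⊆ T
      X⊆T _ (here refl)                 = tx
      X⊆T _ (there (here refl))         = tx'
      X⊆T _ (there (there (here refl))) = tx''
      M₁-dependent : ¬ LinIndep (preimage M₁ ι₁ X)
      M₁-dependent indep =
        triangle⇒dependent (nonzero M₁ x px) (nonzero M₁ x' px') (nonzero M₁ x'' px'') x≢x' x≢x'' x'≢x''
          triangle (LinIndep-⊆ ⊆X indep)
        where
        ⊆X : (_∈ x ∷ x' ∷ x'' ∷ []) ⊆ preimage M₁ ι₁ X
        ⊆X _ (here refl)                 = px , here refl
        ⊆X _ (there (here refl))         = px' , there (here refl)
        ⊆X _ (there (there (here refl))) = px'' , there (there (here refl))
      X₂⊆ : preimage M₂ ι₂ X ⊆ (_∈ y ∷ y' ∷ y'' ∷ [])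
      X₂⊆ z (pz , here e)                 = here (ι₂-inj _ _ pz py (trans e ι₁x≡))
      X₂⊆ z (pz , there (here e))         = there (here (ι₂-inj _ _ pz py' (trans e ι₁x'≡)))
      X₂⊆ z (pz , there (there (here e))) = there (there (here (ι₂-inj _ _ pz py'' (trans e ι₁x''≡))))

    ι₂-⊕ : ∀ y y' → pts M₂ y → pts M₂ y' → T (ι₂ y) → T (ι₂ y') → y ≢ y' →
           pts M₂ (y ⊕ y') × ι₂ (y ⊕ y') ≡ ι₂ y ⊕ ι₂ y'
    ι₂-⊕ y y' py py' ty@((x , px , ι₁x≡) , _) ty'@((x' , px' , ι₁x'≡) , _) y≢y' =
      subst (pts M₂) y''≡y⊕y' py'' ,
      (begin
        ι₂ (y ⊕ y')        ≡⟨ cong ι₂ y''≡y⊕y' ⟨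
        ι₂ y''             ≡⟨ ι₂y''≡ ⟩
        ι₁ (x ⊕ x')        ≡⟨ proj₂ (ι₁-⊕ x x' px px' tx tx' x≢x') ⟩
        ι₁ x ⊕ ι₁ x'       ≡⟨ cong₂ _⊕_ ι₁x≡ ι₁x'≡ ⟩
        ι₂ y ⊕ ι₂ y'       ∎)
      where
      tx : T (ι₁ x)
      tx = subst T (sym ι₁x≡) ty
      tx' : T (ι₁ x')
      tx' = subst T (sym ι₁x'≡) ty'
      x≢x' : x ≢ x'
      x≢x' e = y≢y' (ι₂-inj _ _ py py' (trans (sym ι₁x≡) (trans (cong ι₁ e) ι₁x'≡)))
      Tx⊕x' : T₁ (x ⊕ x')
      Tx⊕x' = T₁-⊕ (px , tx) (px' , tx') x≢x'
      y'' : V r₂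
      y'' = proj₁ (proj₂ (proj₂ Tx⊕x'))
      py'' : pts M₂ y''
      py'' = proj₁ (proj₂ (proj₂ (proj₂ Tx⊕x')))
      ι₂y''≡ : ι₂ y'' ≡ ι₁ (x ⊕ x')
      ι₂y''≡ = proj₂ (proj₂ (proj₂ (proj₂ Tx⊕x')))
      y''≡y⊕y' : y'' ≡ y ⊕ y'
      y''≡y⊕y' = sym (⊕≡𝟘⇒≡ (T-triangle (px , tx) (px' , tx') Tx⊕x' x≢x'
        (λ e → nonzero M₁ x' px' (⊕≡ˡ⇒≡𝟘 (sym e))) (λ e → nonzero M₁ x px (⊕≡ʳ⇒≡𝟘 (sym e))) (⊕-self (x ⊕ x'))
        py py' py'' ι₁x≡ ι₁x'≡ (sym ι₂y''≡)))

    T-list : List (V r)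
    T-list = map (ι₁ ∘ I.f) (nonzeros (allV k))

    T-list⊆T : All T T-list
    T-list⊆T = Allₚ.map⁺ (All-nonzeros {L = allV k} (All.tabulate λ {u} _ u≢𝟘 → proj₂ (I.f-pts u u≢𝟘)))

    T-list-complete : ∀ v → T v → v ∈ T-list
    T-list-complete _ tv@((x , px , refl) , _) =
      subst (_∈ T-list) (cong ι₁ (I.fg x (px , tv)))
        (∈-map⁺ (ι₁ ∘ I.f) (∈-filter⁺ (λ v → ¬? (v ≟V 𝟘)) (∈-allV (I.g x)) (I.g-pts x (px , tv))))

  IsGPC⇒ParallelConnection : ParallelConnection M₁ M₂ M
  IsGPC⇒ParallelConnection = record
    { ι₁ = ι₁ ; ι₂ = ι₂ ; ι₁-pts = ι₁-pts ; ι₂-pts = ι₂-pts ; ι₁-inj = ι₁-inj ; ι₂-inj = ι₂-inj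
    ; cover = cover ; T = T ; T⊆E₁ = λ _ → proj₁ ; T⊆E₂ = λ _ → proj₂ ; E₁∩E₂⊆T = λ _ → _,_
    ; T-⊕ = T-⊕ ; ι₁-⊕ = ι₁-⊕ ; ι₂-⊕ = ι₂-⊕
    ; T-list = T-list ; T-list⊆T = T-list⊆T ; T-list-complete = T-list-complete
    ; preimage₁-Flat = preimage₁-Flat ; preimage₂-Flat = preimage₂-Flat
    ; Flat-from-preimages = λ X X⊆M fl₁ fl₂ → from (flats X X⊆M) (fl₁ , fl₂) }

InN-reflected : ∀ {r s} {M : BinMat r} {N : BinMat s} → (K4Certificate M → K4Certificate N) → InN N → InN M
InN-reflected reflect N∈𝒩 K4≼M = N∈𝒩 (certificate⇒≼ (reflect (≼⇒certificate K4≼M)))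

corollary4p6 :
    (∀ {r₁ r₂ r : ℕ} (M₁ : BinMat r₁) (M₂ : BinMat r₂) (M : BinMat r) →
       IsGPC M₁ M₂ M → InN M₁ → InN M₂ → InN M)
    × (∀ {r : ℕ} (N : BinMat r) → InN N → InN (cone N))
    × (∀ {r : ℕ} (N : BinMat r) → TriangleFree N → InN N → InN (tiplessCone N))
corollary4p6 =
  (λ M₁ M₂ M G M₁∈𝒩 M₂∈𝒩 K4≼M →
     [ M₁∈𝒩 ∘ certificate⇒≼ , M₂∈𝒩 ∘ certificate⇒≼ ]′
       (parallel-connection-certificate (IsGPC⇒ParallelConnection G) (≼⇒certificate K4≼M))) ,
  (λ N → InN-reflected (cone-certificate N)) ,
  (λ N triangle-free → InN-reflected (tipless-certificate N triangle-free))
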